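{- Let $m\ge 2$, $1\le\ell\le m$, let $F=(f_1,\dots,f_\ell)$ be a bent vectorial function from $\mathrm{GF}(2^{2m})$ to $\mathrm{GF}(2)^\ell$, and let $\mathbf{D}$ be the design (with parameters $2$-$(2^{2m},2^{2m-1}-2^{m-1},(2^\ell-1)(2^{2m-2}-2^{m-1}))$) whose points are the $2^{2m}$ coordinate positions and whose blocks are the supports of the minimum-weight codewords of $\mathcal{C}(f_1,\dots,f_\ell)$. (a) If $\ell=1$, $\mathbf{D}$ is a symmetric SDP design, with any two distinct blocks meeting in $2^{2m-2}-2^{m-1}$ points. (b) If $2\le\ell\le m$, any two distinct blocks of $\mathbf{D}$ meet in $s_1=2^{2m-2}-2^{m-2}$, $s_2=2^{2m-2}-2^{m-1}$ or $s_3=2^{2m-2}-3\cdot2^{m-2}$ points, and for every block $B$ of $\mathbf{D}$, the numbers of other blocks meeting $B$ in $s_1,s_2,s_3$ points are respectively $n_1=2^m(2^m+1)(2^{\ell-1}-1)$, $n_2=2^{2m}-1$, $n_3=2^m(2^m-1)(2^{\ell-1}-1)$.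
   Context: Write $\mathrm{GF}(2^{2m})=\{u_1,\dots,u_q\}$, $q=2^{2m}$, and let $\mathrm{tr}_{2m/1}$ be the absolute trace to $\mathrm{GF}(2)$. A Boolean function $f:\mathrm{GF}(2^{2m})\to\mathrm{GF}(2)$ is bent if $\left|\sum_{x}(-1)^{f(x)+\mathrm{tr}_{2m/1}(wx)}\right|=2^m$ for all $w$. $F=(f_1,\dots,f_\ell)$ is a bent vectorial function if $\sum_j a_jf_j$ is bent for every nonzero $(a_1,\dots,a_\ell)\in\mathrm{GF}(2)^\ell$. The truth table of $f$ is $(f(u_1),\dots,f(u_q))$. $\mathrm{RM}_2(1,2m)=\{(\mathrm{tr}_{2m/1}(bu_i)+c)_{i=1}^q:b\in\mathrm{GF}(2^{2m}),c\in\mathrm{GF}(2)\}$, and $\mathcal{C}(f_1,\dots,f_\ell)$ is the binary linear code spanned by $\mathrm{RM}_2(1,2m)$ and the truth tables of $f_1,\dots,f_\ell$; its minimum weight is $2^{2m-1}-2^{m-1}$. A symmetric design is a $2$-design with as many blocks as points; a symmetric $2$-design is an SDP design (has the symmetric difference property) if the symmetric difference of any three blocks is either a block or the complement of a block. -}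

module Defs where

open import Data.Nat using (ℕ; zero; suc; _^_; _≤_)
open import Data.Bool using (Bool; true; false; not; _xor_; _∧_; if_then_else_)
open import Data.Fin using (Fin)
import Data.Fin.Properties as FinP
open import Data.Fin.Subset using (Subset; ∣_∣; _∩_; ∁; _∈_)
open import Data.Vec using (Vec; tabulate; zipWith; replicate)
open import Data.List using (List; length; map; foldr; allFin)
open import Data.List.Membership.Propositional using () renaming (_∈_ to _∈ₗ_)
open import Data.List.Relation.Unary.Unique.Propositional using (Unique)
import Data.Integer as ℤ
open ℤ using (ℤ)
open import Data.Product using (Σ; ∃; ∃-syntax; _×_; _,_)
open import Data.Sum using (_⊎_)
open import Function.Bundles using (_↔_; Inverse; _⇔_)
open import Algebra.Structures using (IsCommutativeRing)
open import Relation.Binary.PropositionalEquality using (_≡_; _≢_; refl; cong; trans; sym)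
open import Relation.Nullary using (Dec; yes; no; does)

-- A finite field of order 2^n (i.e. a model of GF(2^n)), with equality
-- being propositional equality, together with an enumeration
-- u : Fin (2^n) ↔ Carrier (the ordering u_1, ..., u_q of the elements).

record GF2^ (n : ℕ) : Set₁ where
  field
    Carrier : Set
    _+_ _*_ : Carrier → Carrier → Carrier
    -_      : Carrier → Carrier
    0# 1#   : Carrier
    isCommutativeRing : IsCommutativeRing _≡_ _+_ _*_ -_ 0# 1#
    1≢0     : 1# ≢ 0#
    inverse : ∀ x → x ≢ 0# → ∃[ y ] (x * y ≡ 1#)
    enum    : Fin (2 ^ n) ↔ Carrier

  q : ℕ
  q = 2 ^ n

  u : Fin q → Carrier
  u = Inverse.to enum

  _≟_ : (x y : Carrier) → Dec (x ≡ y)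
  x ≟ y with Inverse.from enum x FinP.≟ Inverse.from enum y
  ... | yes p = yes (trans (sym (Inverse.inverseˡ enum refl))
                           (trans (cong (Inverse.to enum) p) (Inverse.inverseˡ enum refl)))
  ... | no ¬p = no (λ e → ¬p (cong (Inverse.from enum) e))

  _^ᶠ_ : Carrier → ℕ → Carrier
  x ^ᶠ zero  = 1#
  x ^ᶠ suc k = x * (x ^ᶠ k)

  trF : Carrier → Carrier
  trF x = foldr _+_ 0# (map (λ (i : Fin n) → x ^ᶠ (2 ^ Data.Fin.toℕ i)) (allFin n))

  -- the absolute trace viewed in GF(2) = Bool (its value is 0# or 1#)
  tr : Carrier → Bool
  tr x = not (does (trF x ≟ 0#))

open GF2^ public using (Carrier; q; u; tr)

sumℤ : List ℤ → ℤ
sumℤ = foldr ℤ._+_ (ℤ.+ 0)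

sign : Bool → ℤ
sign b = if b then ℤ.- (ℤ.+ 1) else ℤ.+ 1

walsh : ∀ {n} (K : GF2^ n) → (Carrier K → Bool) → Carrier K → ℤ
walsh K f w = sumℤ (map (λ i → sign (f (u K i) xor tr K (GF2^._*_ K w (u K i)))) (allFin (q K)))

IsBent : ∀ m (K : GF2^ (2 Data.Nat.* m)) → (Carrier K → Bool) → Set
IsBent m K f = ∀ w → ℤ.∣ walsh K f w ∣ ≡ 2 ^ m

lincomb : ∀ {ℓ} {A : Set} → (Fin ℓ → Bool) → (Fin ℓ → A → Bool) → A → Bool
lincomb {ℓ} a F x = foldr _xor_ false (map (λ j → a j ∧ F j x) (allFin ℓ))

IsBentVectorial : ∀ m (K : GF2^ (2 Data.Nat.* m)) {ℓ} → (Fin ℓ → Carrier K → Bool) → Set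
IsBentVectorial m K F = ∀ (a : Fin _ → Bool) → (∃[ j ] (a j ≡ true)) → IsBent m K (lincomb a F)

-- Binary linear codes (vectors in GF(2)^q are Vec Bool q = Subset q)

_⊕_ : ∀ {k} → Vec Bool k → Vec Bool k → Vec Bool k
_⊕_ = zipWith _xor_

zeroVec : ∀ {k} → Vec Bool k
zeroVec = replicate _ false

data Span {k} (G : Vec Bool k → Set) : Vec Bool k → Set where
  span-zero : Span G zeroVec
  span-gen  : ∀ {v} → G v → Span G v
  span-add  : ∀ {v w} → Span G v → Span G w → Span G (v ⊕ w)

truthTable : ∀ {n} (K : GF2^ n) → (Carrier K → Bool) → Vec Bool (q K)
truthTable K f = tabulate (λ i → f (u K i))

InRM1 : ∀ {n} (K : GF2^ n) → Vec Bool (q K) → Set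
InRM1 K v = ∃[ b ] ∃[ c ] (v ≡ tabulate (λ i → tr K (GF2^._*_ K b (u K i)) xor c))

InCode : ∀ {n} (K : GF2^ n) {ℓ} → (Fin ℓ → Carrier K → Bool) → Vec Bool (q K) → Set
InCode K F = Span (λ v → InRM1 K v ⊎ ∃[ j ] (v ≡ truthTable K (F j)))

wt : ∀ {k} → Vec Bool k → ℕ
wt = ∣_∣

IsMinWeightCodeword : ∀ {k} → (Vec Bool k → Set) → Vec Bool k → Set
IsMinWeightCodeword C c = C c × c ≢ zeroVec × (∀ c' → C c' → c' ≢ zeroVec → wt c ≤ wt c')

support : ∀ {k} → Vec Bool k → Subset k
support c = c

IsBlock : ∀ {n} (K : GF2^ n) {ℓ} → (Fin ℓ → Carrier K → Bool) → Subset (q K) → Set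
IsBlock K F B = ∃[ c ] (IsMinWeightCodeword (InCode K F) c × B ≡ support c)

HasCount : ∀ {k} → (Subset k → Set) → ℕ → Set
HasCount P N = Σ (List (Subset _)) λ L → Unique L × length L ≡ N × (∀ B → (B ∈ₗ L) ⇔ P B)

Is2Design : ∀ {k} → (Subset k → Set) → Set
Is2Design {k} Blk =
  Σ ℕ λ kk → Σ ℕ λ λ' →
    (∀ B → Blk B → ∣ B ∣ ≡ kk) ×
    (∀ (i j : Fin k) → i ≢ j → HasCount (λ B → Blk B × i ∈ B × j ∈ B) λ')

IsSymmetricDesign : ∀ {k} → (Subset k → Set) → Set
IsSymmetricDesign {k} Blk = Is2Design Blk × HasCount Blk k

HasSDP : ∀ {k} → (Subset k → Set) → Set
HasSDP Blk = ∀ B₁ B₂ B₃ → Blk B₁ → Blk B₂ → Blk B₃ →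
  Blk ((B₁ ⊕ B₂) ⊕ B₃) ⊎ Blk (∁ ((B₁ ⊕ B₂) ⊕ B₃))

IsSymmetricSDPDesign : ∀ {k} → (Subset k → Set) → Set
IsSymmetricSDPDesign Blk = IsSymmetricDesign Blk × HasSDP Blk

module Submission where

-- Every codeword of C(f_1, ..., f_ℓ) is the truth table of f_a(x) + tr(b x) + c, of weight
-- (q - (-1)^c W_{f_a}(b)) / 2. For a ≠ 0 the function f_a is bent, so W_{f_a}(b) = ±2^m, while for
-- a = 0 the Walsh value is q or 0. Hence the minimum weight q/2 - 2^(m-1) is attained exactly when
-- a ≠ 0 and c is the dual bit of f_a at b, and the blocks are labelled injectively by the pairs (a, b).
-- The sum of two blocks is the codeword labelled (a + a′, b + b′), whose weight gives the size of
-- their intersection: its Walsh value is ±2^m if a ≠ a′ (sizes s₁, s₃) and 0 if a = a′ (size s₂).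
-- Counting uses character sums over b′: the convolution of Walsh transforms shows that the signs
-- separating s₁ from s₃ sum to 2^m, and for ℓ = 1 Fourier inversion gives the 2-design property,
-- while the sum of three blocks is a codeword with a = 1, hence a block or a block's complement.
-- That GF(2^n) has characteristic 2 and a nonzero trace is derived from the field axioms, via
-- Fermat's little theorem and a root bound for the trace polynomial.

module FiniteField where

  open import Defs hiding (q; u; tr)
  open import Data.Nat as ℕ using (ℕ; zero; suc; _<_; s≤s; z≤n)
  import Data.Nat.Properties as ℕP
  open import Data.Fin as Fin using (Fin; toℕ)
  import Data.Fin.Properties as FinP
  open import Data.Bool using (Bool; true; false; _xor_)
  open import Data.List using (List; []; _∷_; map; foldr; allFin; tabulate; length)
  import Data.List.Properties as LP
  open import Data.List.Relation.Unary.All using (All; []; _∷_)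
  open import Data.List.Relation.Unary.Unique.Propositional using (Unique; []; _∷_)
  import Data.List.Relation.Unary.Unique.Propositional.Properties as UP
  open import Data.Product using (Σ; ∃-syntax; _×_; _,_; proj₁; proj₂)
  open import Data.Sum using (_⊎_; inj₁; inj₂)
  open import Data.Empty using (⊥; ⊥-elim)
  open import Function using (_∘_; Inverse; id)
  open import Algebra.Bundles using (CommutativeRing)
  import Algebra.Properties.CommutativeMonoid.Sum
  open import Relation.Binary.PropositionalEquality
  open import Relation.Nullary using (yes; no)
  open import Data.Fin.Permutation using (Permutation; permutation)

  2^n≡suc : ∀ n → ∃[ j ] (2 ℕ.^ n ≡ suc j)
  2^n≡suc n with 2 ℕ.^ n | ℕP.m^n≢0 2 n
  ... | suc j | _ = j , refl

  module Properties {n : ℕ} (K : GF2^ (suc n)) where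
    commutativeRing : CommutativeRing _ _
    commutativeRing = record { isCommutativeRing = GF2^.isCommutativeRing K }
    open CommutativeRing commutativeRing public
      using (_+_; _*_; -_; 0#; 1#; +-comm; +-assoc; *-comm; *-assoc;
             +-identityˡ; +-identityʳ; *-identityˡ; *-identityʳ; distribˡ; distribʳ;
             -‿inverseʳ; zeroˡ; zeroʳ)
    open import Algebra.Properties.Ring (CommutativeRing.ring commutativeRing) using (-‿distribˡ-*; -‿involutive)
    open GF2^ K public using (enum; u; q; _≟_; _^ᶠ_; trF; tr; inverse; 1≢0)
    open import Algebra.Solver.Ring.NaturalCoefficients.Default (CommutativeRing.commutativeSemiring commutativeRing)
      public using (solve; _:=_; _:+_; _:*_; con)
    open ≡-Reasoning

    𝔽 : Set
    𝔽 = Carrier K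

    index : 𝔽 → Fin q
    index = Inverse.from enum

    u∘index : ∀ x → u (index x) ≡ x
    u∘index x = Inverse.inverseˡ enum refl

    index∘u : ∀ i → index (u i) ≡ i
    index∘u i = Inverse.inverseʳ enum refl

    u-injective : ∀ {i j} → u i ≡ u j → i ≡ j
    u-injective {i} {j} e = trans (sym (index∘u i)) (trans (cong index e) (index∘u j))

    permutationOf : (σ σ⁻¹ : 𝔽 → 𝔽) → (∀ x → σ (σ⁻¹ x) ≡ x) → (∀ x → σ⁻¹ (σ x) ≡ x) → Permutation q q
    permutationOf σ σ⁻¹ σσ⁻¹ σ⁻¹σ = permutation (λ i → index (σ (u i))) (λ i → index (σ⁻¹ (u i)))
      (λ i → trans (cong (index ∘ σ) (u∘index _)) (trans (cong index (σσ⁻¹ (u i))) (index∘u i)))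
      (λ i → trans (cong (index ∘ σ⁻¹) (u∘index _)) (trans (cong index (σ⁻¹σ (u i))) (index∘u i)))

    inv : ∀ x → x ≢ 0# → 𝔽
    inv x x≢0 = proj₁ (inverse x x≢0)

    inv-inverseʳ : ∀ x (x≢0 : x ≢ 0#) → x * inv x x≢0 ≡ 1#
    inv-inverseʳ x x≢0 = proj₂ (inverse x x≢0)

    x*y≡0⇒y≡0 : ∀ x y → x ≢ 0# → x * y ≡ 0# → y ≡ 0#
    x*y≡0⇒y≡0 x y x≢0 e = begin
      y                        ≡⟨ sym (*-identityˡ y) ⟩
      1# * y                   ≡⟨ cong (_* y) (sym (inv-inverseʳ x x≢0)) ⟩
      (x * inv x x≢0) * y      ≡⟨ solve 3 (λ a b c → (a :* b) :* c := b :* (a :* c)) refl x (inv x x≢0) y ⟩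
      inv x x≢0 * (x * y)      ≡⟨ cong (inv x x≢0 *_) e ⟩
      inv x x≢0 * 0#           ≡⟨ zeroʳ _ ⟩
      0#                       ∎

    *-nonzero : ∀ x y → x ≢ 0# → y ≢ 0# → x * y ≢ 0#
    *-nonzero x y x≢0 y≢0 e = y≢0 (x*y≡0⇒y≡0 x y x≢0 e)

    *-cancelʳ : ∀ a b c → c ≢ 0# → a * c ≡ b * c → a ≡ b
    *-cancelʳ a b c c≢0 e = begin
      a                        ≡⟨ sym (*-identityʳ a) ⟩
      a * 1#                   ≡⟨ cong (a *_) (sym (inv-inverseʳ c c≢0)) ⟩
      a * (c * inv c c≢0)      ≡⟨ sym (*-assoc a c _) ⟩
      a * c * inv c c≢0        ≡⟨ cong (_* inv c c≢0) e ⟩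
      b * c * inv c c≢0        ≡⟨ *-assoc b c _ ⟩
      b * (c * inv c c≢0)      ≡⟨ cong (b *_) (inv-inverseʳ c c≢0) ⟩
      b * 1#                   ≡⟨ *-identityʳ b ⟩
      b                        ∎

    ^ᶠ-distribˡ-+-* : ∀ x a b → x ^ᶠ (a ℕ.+ b) ≡ x ^ᶠ a * x ^ᶠ b
    ^ᶠ-distribˡ-+-* x zero    b = sym (*-identityˡ _)
    ^ᶠ-distribˡ-+-* x (suc a) b = trans (cong (x *_) (^ᶠ-distribˡ-+-* x a b)) (sym (*-assoc x _ _))

    ^ᶠ-distribʳ-* : ∀ x y k → (x * y) ^ᶠ k ≡ x ^ᶠ k * y ^ᶠ k
    ^ᶠ-distribʳ-* x y zero    = sym (*-identityˡ 1#)
    ^ᶠ-distribʳ-* x y (suc k) = trans (cong ((x * y) *_) (^ᶠ-distribʳ-* x y k))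
      (solve 4 (λ a b c d → (a :* b) :* (c :* d) := (a :* c) :* (b :* d)) refl x y _ _)

    1^ᶠ≡1 : ∀ k → 1# ^ᶠ k ≡ 1#
    1^ᶠ≡1 zero    = refl
    1^ᶠ≡1 (suc k) = trans (*-identityˡ _) (1^ᶠ≡1 k)

    ^ᶠ-2* : ∀ x k → x ^ᶠ (2 ℕ.* k) ≡ (x * x) ^ᶠ k
    ^ᶠ-2* x k = begin
      x ^ᶠ (k ℕ.+ (k ℕ.+ 0))   ≡⟨ cong (λ t → x ^ᶠ (k ℕ.+ t)) (ℕP.+-identityʳ k) ⟩
      x ^ᶠ (k ℕ.+ k)           ≡⟨ ^ᶠ-distribˡ-+-* x k k ⟩
      x ^ᶠ k * x ^ᶠ k          ≡⟨ sym (^ᶠ-distribʳ-* x x k) ⟩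
      (x * x) ^ᶠ k             ∎

    module ∏ = Algebra.Properties.CommutativeMonoid.Sum (CommutativeRing.*-commutativeMonoid commutativeRing)

    ∏ : ∀ {N} → (Fin N → 𝔽) → 𝔽
    ∏ = ∏.sum

    ∏-single : ∀ {N} (t : Fin N → 𝔽) i → (∀ j → j ≢ i → t j ≡ 1#) → ∏ t ≡ t i
    ∏-single {suc N} t Fin.zero    t≡1 = trans (cong (t Fin.zero *_) (∏-ones (t ∘ Fin.suc) (λ j → t≡1 (Fin.suc j) λ ()))) (*-identityʳ _)
      where
      ∏-ones : ∀ {N} (t : Fin N → 𝔽) → (∀ j → t j ≡ 1#) → ∏ t ≡ 1#
      ∏-ones {zero}  t e = refl
      ∏-ones {suc N} t e = trans (cong₂ _*_ (e Fin.zero) (∏-ones (t ∘ Fin.suc) (e ∘ Fin.suc))) (*-identityˡ 1#)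
    ∏-single {suc N} t (Fin.suc i) t≡1 =
      trans (cong (_* ∏ (t ∘ Fin.suc)) (t≡1 Fin.zero λ ()))
        (trans (*-identityˡ _) (∏-single (t ∘ Fin.suc) i (λ j j≢i → t≡1 (Fin.suc j) (j≢i ∘ FinP.suc-injective))))

    ∏-scale : ∀ {N} c (f : Fin N → 𝔽) → ∏ (λ i → c * f i) ≡ c ^ᶠ N * ∏ f
    ∏-scale {zero}  c f = sym (*-identityˡ 1#)
    ∏-scale {suc N} c f = trans (cong (c * f Fin.zero *_) (∏-scale c (f ∘ Fin.suc)))
      (solve 4 (λ a b d e → a :* b :* (d :* e) := a :* d :* (b :* e)) refl c (f Fin.zero) (c ^ᶠ N) _)

    ∏-nonzero : ∀ {N} (f : Fin N → 𝔽) → (∀ i → f i ≢ 0#) → ∏ f ≢ 0#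
    ∏-nonzero {zero}  f f≢0 = 1≢0
    ∏-nonzero {suc N} f f≢0 = *-nonzero _ _ (f≢0 Fin.zero) (∏-nonzero (f ∘ Fin.suc) (f≢0 ∘ Fin.suc))

    nonzeroPart : 𝔽 → 𝔽
    nonzeroPart y with y ≟ 0#
    ... | yes _ = 1#
    ... | no  _ = y

    nonzeroPart≢0 : ∀ y → nonzeroPart y ≢ 0#
    nonzeroPart≢0 y with y ≟ 0#
    ... | yes _   = 1≢0
    ... | no  y≢0 = y≢0

    defect : 𝔽 → 𝔽 → 𝔽
    defect x y with y ≟ 0#
    ... | yes _ = x
    ... | no  _ = 1#

    nonzeroPart-* : ∀ x y → x ≢ 0# → x * nonzeroPart y ≡ nonzeroPart (x * y) * defect x y
    nonzeroPart-* x y x≢0 with y ≟ 0# | (x * y) ≟ 0#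
    ... | yes _   | yes _  = trans (*-identityʳ x) (sym (*-identityˡ x))
    ... | yes y≡0 | no xy≢0 = ⊥-elim (xy≢0 (trans (cong (x *_) y≡0) (zeroʳ x)))
    ... | no  y≢0 | yes xy≡0 = ⊥-elim (*-nonzero x y x≢0 y≢0 xy≡0)
    ... | no  _   | no  _  = sym (*-identityʳ _)

    -- Multiplication by x ≢ 0 permutes 𝔽, so scaling each of the q factors of P = ∏ nonzeroPart by x
    -- permutes them, except that the factor at 0 picks up the defect x: x^q P = P x.
    fermat-nonzero : ∀ x → x ≢ 0# → x ^ᶠ q ≡ x
    fermat-nonzero x x≢0 = *-cancelʳ _ _ P (∏-nonzero (nonzeroPart ∘ u) (nonzeroPart≢0 ∘ u)) (begin
      x ^ᶠ q * P                                         ≡⟨ sym (∏-scale x (nonzeroPart ∘ u)) ⟩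
      ∏ (λ i → x * nonzeroPart (u i))                    ≡⟨ ∏.sum-cong-≗ (λ i → nonzeroPart-* x (u i) x≢0) ⟩
      ∏ (λ i → nonzeroPart (x * u i) * defect x (u i))   ≡⟨ ∏.∑-distrib-+ (λ i → nonzeroPart (x * u i)) (λ i → defect x (u i)) ⟩
      ∏ (λ i → nonzeroPart (x * u i)) * ∏ (defect x ∘ u) ≡⟨ cong₂ _*_ (sym P-permute) ∏-defect ⟩
      P * x                                              ≡⟨ *-comm P x ⟩
      x * P                                              ∎)
      where
      P = ∏ (nonzeroPart ∘ u)
      x⁻¹ = inv x x≢0
      x*x⁻¹* : ∀ y → x * (x⁻¹ * y) ≡ y
      x*x⁻¹* y = trans (sym (*-assoc x x⁻¹ y)) (trans (cong (_* y) (inv-inverseʳ x x≢0)) (*-identityˡ y))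
      x⁻¹*x* : ∀ y → x⁻¹ * (x * y) ≡ y
      x⁻¹*x* y = trans (sym (*-assoc x⁻¹ x y)) (trans (cong (_* y) (trans (*-comm x⁻¹ x) (inv-inverseʳ x x≢0))) (*-identityˡ y))
      P-permute : P ≡ ∏ (λ i → nonzeroPart (x * u i))
      P-permute = trans (∏.sum-permute (nonzeroPart ∘ u) (permutationOf (x *_) (x⁻¹ *_) x*x⁻¹* x⁻¹*x*))
                        (∏.sum-cong-≗ (λ i → cong nonzeroPart (u∘index (x * u i))))
      ∏-defect : ∏ (defect x ∘ u) ≡ x
      ∏-defect = trans (∏-single (defect x ∘ u) (index 0#) defect≡1) (trans (cong (defect x) (u∘index 0#)) defect-0)
        where
        defect-0 : defect x 0# ≡ x
        defect-0 with 0# ≟ 0#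
        ... | yes _   = refl
        ... | no  0≢0 = ⊥-elim (0≢0 refl)
        defect≡1 : ∀ j → j ≢ index 0# → defect x (u j) ≡ 1#
        defect≡1 j j≢ with u j ≟ 0#
        ... | yes uj≡0 = ⊥-elim (j≢ (trans (sym (index∘u j)) (cong index uj≡0)))
        ... | no  _    = refl

    fermat : ∀ x → x ^ᶠ q ≡ x
    fermat x with x ≟ 0# | 2^n≡suc (suc n)
    ... | no x≢0 | _      = fermat-nonzero x x≢0
    ... | yes refl | j , e = trans (cong (0# ^ᶠ_) e) (zeroˡ _)

    1+1≡0 : 1# + 1# ≡ 0#
    1+1≡0 = trans (cong (1# +_) (sym -1≡1)) (-‿inverseʳ 1#)
      where
      -1≡1 : - 1# ≡ 1#
      -1≡1 = begin
        - 1#                                ≡⟨ sym (fermat (- 1#)) ⟩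
        (- 1#) ^ᶠ (2 ℕ.* (2 ℕ.^ n))          ≡⟨ ^ᶠ-2* (- 1#) (2 ℕ.^ n) ⟩
        ((- 1#) * (- 1#)) ^ᶠ (2 ℕ.^ n)       ≡⟨ cong (_^ᶠ (2 ℕ.^ n)) (trans (sym (-‿distribˡ-* 1# (- 1#)))
                                                   (trans (cong -_ (*-identityˡ (- 1#))) (-‿involutive 1#))) ⟩
        1# ^ᶠ (2 ℕ.^ n)                      ≡⟨ 1^ᶠ≡1 (2 ℕ.^ n) ⟩
        1#                                  ∎

    x+x≡0 : ∀ x → x + x ≡ 0#
    x+x≡0 x = begin
      x + x          ≡⟨ solve 1 (λ a → a :+ a := a :* (con 1 :+ con 1)) refl x ⟩
      x * (1# + 1#)  ≡⟨ cong (x *_) 1+1≡0 ⟩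
      x * 0#         ≡⟨ zeroʳ x ⟩
      0#             ∎

    x+y+y≡x : ∀ x y → x + y + y ≡ x
    x+y+y≡x x y = trans (+-assoc x y y) (trans (cong (x +_) (x+x≡0 y)) (+-identityʳ x))

    x+y≡0⇒x≡y : ∀ x y → x + y ≡ 0# → x ≡ y
    x+y≡0⇒x≡y x y e = trans (sym (x+y+y≡x x y)) (trans (cong (_+ y) e) (+-identityˡ y))

    frobenius : ∀ x y → (x + y) * (x + y) ≡ x * x + y * y
    frobenius x y = begin
      (x + y) * (x + y)                 ≡⟨ solve 2 (λ a b → (a :+ b) :* (a :+ b) := a :* a :+ b :* b :+ (a :* b :+ a :* b)) refl x y ⟩
      x * x + y * y + (x * y + x * y)   ≡⟨ cong (x * x + y * y +_) (x+x≡0 (x * y)) ⟩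
      x * x + y * y + 0#                ≡⟨ +-identityʳ _ ⟩
      x * x + y * y                     ∎

    squareⁱ : ℕ → 𝔽 → 𝔽
    squareⁱ zero    x = x
    squareⁱ (suc k) x = squareⁱ k (x * x)

    squareⁱ≡^2^ : ∀ k x → squareⁱ k x ≡ x ^ᶠ (2 ℕ.^ k)
    squareⁱ≡^2^ zero    x = sym (*-identityʳ x)
    squareⁱ≡^2^ (suc k) x = trans (squareⁱ≡^2^ k (x * x)) (sym (^ᶠ-2* x (2 ℕ.^ k)))

    partialTrace : ℕ → 𝔽 → 𝔽
    partialTrace zero    x = 0#
    partialTrace (suc k) x = x + partialTrace k (x * x)

    partialTrace-+ : ∀ k x y → partialTrace k (x + y) ≡ partialTrace k x + partialTrace k y
    partialTrace-+ zero    x y = sym (+-identityˡ 0#)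
    partialTrace-+ (suc k) x y = begin
      x + y + partialTrace k ((x + y) * (x + y))                    ≡⟨ cong (λ t → x + y + partialTrace k t) (frobenius x y) ⟩
      x + y + partialTrace k (x * x + y * y)                        ≡⟨ cong (x + y +_) (partialTrace-+ k (x * x) (y * y)) ⟩
      x + y + (partialTrace k (x * x) + partialTrace k (y * y))     ≡⟨ solve 4 (λ a b c d → a :+ b :+ (c :+ d) := a :+ c :+ (b :+ d)) refl x y _ _ ⟩
      x + partialTrace k (x * x) + (y + partialTrace k (y * y))     ∎

    partialTrace-square : ∀ k x → partialTrace k x * partialTrace k x ≡ partialTrace k (x * x)
    partialTrace-square zero    x = zeroˡ 0#
    partialTrace-square (suc k) x = trans (frobenius x _) (cong (x * x +_) (partialTrace-square k (x * x)))

    partialTrace-suc : ∀ k x → partialTrace (suc k) x ≡ partialTrace k x + squareⁱ k x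
    partialTrace-suc zero    x = trans (+-identityʳ x) (sym (+-identityˡ x))
    partialTrace-suc (suc k) x = trans (cong (x +_) (partialTrace-suc k (x * x))) (sym (+-assoc x _ _))

    trF≡partialTrace : ∀ x → trF x ≡ partialTrace (suc n) x
    trF≡partialTrace x = begin
      foldr _+_ 0# (map (λ i → x ^ᶠ (2 ℕ.^ toℕ i)) (allFin (suc n)))  ≡⟨ cong (foldr _+_ 0#) (LP.map-tabulate {n = suc n} id _) ⟩
      foldr _+_ 0# (tabulate {n = suc n} (λ i → x ^ᶠ (2 ℕ.^ toℕ i)))     ≡⟨ cong (foldr _+_ 0#) (LP.tabulate-cong {n = suc n} (λ i → sym (squareⁱ≡^2^ (toℕ i) x))) ⟩
      foldr _+_ 0# (tabulate {n = suc n} (λ i → squareⁱ (toℕ i) x))     ≡⟨ foldr-squareⁱ (suc n) x ⟩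
      partialTrace (suc n) x                                         ∎
      where
      foldr-squareⁱ : ∀ k x → foldr _+_ 0# (tabulate {n = k} (λ i → squareⁱ (toℕ i) x)) ≡ partialTrace k x
      foldr-squareⁱ zero    x = refl
      foldr-squareⁱ (suc k) x = cong (x +_) (foldr-squareⁱ k (x * x))

    -- the trace is idempotent because x^q = x, so it takes only the values 0 and 1
    trF≡0⊎trF≡1 : ∀ x → trF x ≡ 0# ⊎ trF x ≡ 1#
    trF≡0⊎trF≡1 x with trF x ≟ 0#
    ... | yes t≡0 = inj₁ t≡0
    ... | no  t≢0 = inj₂ (*-cancelʳ (trF x) 1# (trF x) t≢0 (trans trF-idempotent (sym (*-identityˡ _))))
      where
      T = partialTrace (suc n)
      trF-idempotent : trF x * trF x ≡ trF x
      trF-idempotent = begin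
        trF x * trF x                ≡⟨ cong₂ _*_ (trF≡partialTrace x) (trF≡partialTrace x) ⟩
        T x * T x                    ≡⟨ partialTrace-square (suc n) x ⟩
        T (x * x)                    ≡⟨ sym (x+y+y≡x (T (x * x)) x) ⟩
        T (x * x) + x + x            ≡⟨ cong (_+ x) (+-comm _ x) ⟩
        partialTrace (suc (suc n)) x + x ≡⟨ cong (_+ x) (partialTrace-suc (suc n) x) ⟩
        T x + squareⁱ (suc n) x + x  ≡⟨ cong (λ s → T x + s + x) (trans (squareⁱ≡^2^ (suc n) x) (fermat x)) ⟩
        T x + x + x                  ≡⟨ x+y+y≡x (T x) x ⟩
        T x                          ≡⟨ sym (trF≡partialTrace x) ⟩
        trF x                        ∎

    toField : Bool → 𝔽
    toField true  = 1#
    toField false = 0#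

    toField-injective : ∀ a b → toField a ≡ toField b → a ≡ b
    toField-injective true  true  e = refl
    toField-injective true  false e = ⊥-elim (1≢0 e)
    toField-injective false true  e = ⊥-elim (1≢0 (sym e))
    toField-injective false false e = refl

    toField-xor : ∀ a b → toField (a xor b) ≡ toField a + toField b
    toField-xor true  true  = sym 1+1≡0
    toField-xor true  false = sym (+-identityʳ 1#)
    toField-xor false b     = sym (+-identityˡ _)

    trF≡toField∘tr : ∀ x → trF x ≡ toField (tr x)
    trF≡toField∘tr x with trF x ≟ 0# | trF≡0⊎trF≡1 x
    ... | yes t≡0 | _        = t≡0
    ... | no  t≢0 | inj₁ t≡0 = ⊥-elim (t≢0 t≡0)
    ... | no  _   | inj₂ t≡1 = t≡1

    tr-+ : ∀ x y → tr (x + y) ≡ tr x xor tr y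
    tr-+ x y = toField-injective _ _ (begin
      toField (tr (x + y))                ≡⟨ sym (trF≡toField∘tr (x + y)) ⟩
      trF (x + y)                         ≡⟨ trans (trF≡partialTrace (x + y)) (partialTrace-+ (suc n) x y) ⟩
      partialTrace (suc n) x + partialTrace (suc n) y ≡⟨ sym (cong₂ _+_ (trF≡partialTrace x) (trF≡partialTrace y)) ⟩
      trF x + trF y                       ≡⟨ cong₂ _+_ (trF≡toField∘tr x) (trF≡toField∘tr y) ⟩
      toField (tr x) + toField (tr y)     ≡⟨ sym (toField-xor (tr x) (tr y)) ⟩
      toField (tr x xor tr y)             ∎)

    tr-0 : tr 0# ≡ false
    tr-0 = toField-injective _ _ (trans (sym (trF≡toField∘tr 0#)) (trans (trF≡partialTrace 0#) (partialTrace-0 (suc n))))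
      where
      partialTrace-0 : ∀ k → partialTrace k 0# ≡ 0#
      partialTrace-0 zero    = refl
      partialTrace-0 (suc k) = trans (cong (λ t → 0# + partialTrace k t) (zeroˡ 0#)) (trans (+-identityˡ _) (partialTrace-0 k))

    -- p is (the function of) a monic polynomial of degree d, given in Horner form
    Monic : ℕ → (𝔽 → 𝔽) → Set
    Monic zero    p = ∀ x → p x ≡ 1#
    Monic (suc d) p = Σ 𝔽 λ c → Σ (𝔽 → 𝔽) λ p′ → Monic d p′ × (∀ x → p x ≡ c + x * p′ x)

    Monic-resp-≗ : ∀ d {p p′} → (∀ x → p x ≡ p′ x) → Monic d p → Monic d p′
    Monic-resp-≗ zero    e monic x = trans (sym (e x)) (monic x)
    Monic-resp-≗ (suc d) e (c , p′ , monic , horner) = c , p′ , monic , λ x → trans (sym (e x)) (horner x)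

    Monic-factor : ∀ d p → Monic (suc d) p → ∀ r → Σ (𝔽 → 𝔽) λ p′ → Monic d p′ × (∀ x → p x ≡ (x + r) * p′ x + p r)
    Monic-factor zero p (c , p₀ , monic , horner) r = p₀ , monic , λ x → begin
      p x                                   ≡⟨ horner x ⟩
      c + x * p₀ x                          ≡⟨ cong (λ t → c + x * t) (monic x) ⟩
      c + x * 1#                            ≡⟨ sym (x+y+y≡x _ r) ⟩
      c + x * 1# + r + r                    ≡⟨ solve 3 (λ c x r → c :+ x :* con 1 :+ r :+ r := (x :+ r) :* con 1 :+ (c :+ r :* con 1)) refl c x r ⟩
      (x + r) * 1# + (c + r * 1#)           ≡⟨ sym (cong₂ (λ a b → (x + r) * a + (c + r * b)) (monic x) (monic r)) ⟩
      (x + r) * p₀ x + (c + r * p₀ r)       ≡⟨ cong ((x + r) * p₀ x +_) (sym (horner r)) ⟩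
      (x + r) * p₀ x + p r                  ∎
    Monic-factor (suc d) p (c , p₀ , monic , horner) r with Monic-factor d p₀ monic r
    ... | p₁ , monic₁ , factored = (λ x → p₀ r + x * p₁ x) , (p₀ r , p₁ , monic₁ , λ x → refl) , λ x → begin
      p x                                                   ≡⟨ horner x ⟩
      c + x * p₀ x                                          ≡⟨ cong (λ t → c + x * t) (factored x) ⟩
      c + x * ((x + r) * p₁ x + p₀ r)                       ≡⟨ sym (x+y+y≡x _ (r * p₀ r)) ⟩
      c + x * ((x + r) * p₁ x + p₀ r) + r * p₀ r + r * p₀ r ≡⟨ solve 5 (λ c x r a b → c :+ x :* ((x :+ r) :* b :+ a) :+ r :* a :+ r :* a
                                                                    := (x :+ r) :* (a :+ x :* b) :+ (c :+ r :* a)) refl c x r (p₀ r) (p₁ x) ⟩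
      (x + r) * (p₀ r + x * p₁ x) + (c + r * p₀ r)          ≡⟨ cong ((x + r) * (p₀ r + x * p₁ x) +_) (sym (horner r)) ⟩
      (x + r) * (p₀ r + x * p₁ x) + p r                     ∎

    Monic-rootBound : ∀ d p → Monic d p → (rs : List 𝔽) → Unique rs → d < length rs → All (λ r → p r ≡ 0#) rs → ⊥
    Monic-rootBound zero    p monic (r ∷ rs) _ _ (pr≡0 ∷ _) = 1≢0 (trans (sym (monic r)) pr≡0)
    Monic-rootBound (suc d) p monic (r ∷ rs) (r∉rs ∷ unique) (s≤s d<) (pr≡0 ∷ roots) with Monic-factor d p monic r
    ... | p′ , monic′ , factored = Monic-rootBound d p′ monic′ rs unique d< (rootsOfQuotient rs r∉rs roots)
      where
      rootsOfQuotient : ∀ ys → All (r ≢_) ys → All (λ y → p y ≡ 0#) ys → All (λ y → p′ y ≡ 0#) ys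
      rootsOfQuotient []       []           []             = []
      rootsOfQuotient (y ∷ ys) (r≢y ∷ r≢ys) (py≡0 ∷ pys≡0) =
        x*y≡0⇒y≡0 (y + r) (p′ y) (λ e → r≢y (sym (x+y≡0⇒x≡y y r e))) (begin
          (y + r) * p′ y           ≡⟨ sym (+-identityʳ _) ⟩
          (y + r) * p′ y + 0#      ≡⟨ cong ((y + r) * p′ y +_) (sym pr≡0) ⟩
          (y + r) * p′ y + p r     ≡⟨ sym (factored y) ⟩
          p y                      ≡⟨ py≡0 ⟩
          0#                       ∎)
        ∷ rootsOfQuotient ys r≢ys pys≡0

    Monic-∘square : ∀ d p → Monic d p → Monic (d ℕ.+ d) (λ x → p (x * x))
    Monic-∘square zero    p monic x = monic (x * x)
    Monic-∘square (suc d) p (c , p′ , monic , horner) =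
      subst (λ t → Monic (suc t) (λ x → p (x * x))) (sym (ℕP.+-suc d d))
        (c , (λ x → 0# + x * p′ (x * x)) , (0# , (λ x → p′ (x * x)) , Monic-∘square d p′ monic , λ x → refl) ,
          λ x → trans (horner (x * x)) (solve 3 (λ c x b → c :+ (x :* x) :* b := c :+ x :* (con 0 :+ x :* b)) refl c x (p′ (x * x))))

    Monic-+id : ∀ d p → Monic (suc (suc d)) p → Monic (suc (suc d)) (λ x → x + p x)
    Monic-+id d p (c , p₁ , (c′ , p₂ , monic , horner₁) , horner) =
      c , (λ x → (1# + c′) + x * p₂ x) , (1# + c′ , p₂ , monic , λ x → refl) , λ x → begin
        x + p x                              ≡⟨ cong (x +_) (horner x) ⟩
        x + (c + x * p₁ x)                   ≡⟨ cong (λ t → x + (c + x * t)) (horner₁ x) ⟩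
        x + (c + x * (c′ + x * p₂ x))        ≡⟨ solve 4 (λ x c c′ b → x :+ (c :+ x :* (c′ :+ x :* b)) := c :+ x :* ((con 1 :+ c′) :+ x :* b)) refl x c c′ (p₂ x) ⟩
        c + x * ((1# + c′) + x * p₂ x)       ∎

    partialTrace-monic : ∀ k → Monic (2 ℕ.^ k) (partialTrace (suc k))
    partialTrace-monic zero = 0# , (λ _ → 1#) , (λ _ → refl) , λ x → trans (+-identityʳ x) (solve 1 (λ x → x := con 0 :+ x :* con 1) refl x)
    partialTrace-monic (suc k) with 2^n≡suc k
    ... | j , e = subst (λ d → Monic d (partialTrace (suc (suc k)))) deg
        (Monic-+id (j ℕ.+ j) (λ x → partialTrace (suc k) (x * x))
          (subst (λ d → Monic d (λ x → partialTrace (suc k) (x * x))) deg′ (Monic-∘square (2 ℕ.^ k) (partialTrace (suc k)) (partialTrace-monic k))))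
      where
      deg′ : 2 ℕ.^ k ℕ.+ 2 ℕ.^ k ≡ suc (suc (j ℕ.+ j))
      deg′ = trans (cong₂ ℕ._+_ e e) (cong suc (ℕP.+-suc j j))
      deg : suc (suc (j ℕ.+ j)) ≡ 2 ℕ.^ suc k
      deg = trans (sym deg′) (cong (2 ℕ.^ k ℕ.+_) (sym (ℕP.+-identityʳ (2 ℕ.^ k))))

    findTraceOne : (ys : List 𝔽) → ∃[ y ] (tr y ≡ true) ⊎ All (λ y → trF y ≡ 0#) ys
    findTraceOne []       = inj₂ []
    findTraceOne (y ∷ ys) with tr y in tr-y | findTraceOne ys
    ... | true  | _          = inj₁ (y , tr-y)
    ... | false | inj₁ found = inj₁ found
    ... | false | inj₂ zeros = inj₂ (trans (trF≡toField∘tr y) (cong toField tr-y) ∷ zeros)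

    -- the trace is a polynomial of degree 2^n < q, so it cannot vanish on all of 𝔽
    ∃tr≡true : ∃[ y ] (tr y ≡ true)
    ∃tr≡true with findTraceOne (map u (allFin q))
    ... | inj₁ found = found
    ... | inj₂ zeros = ⊥-elim (Monic-rootBound (2 ℕ.^ n) trF (Monic-resp-≗ _ (λ x → sym (trF≡partialTrace x)) (partialTrace-monic n))
           (map u (allFin q)) (UP.map⁺ u-injective (UP.allFin⁺ q)) deg<q zeros)
      where
      deg<q : 2 ℕ.^ n < length (map u (allFin q))
      deg<q with 2^n≡suc n
      ... | j , e = subst (2 ℕ.^ n <_) (sym (trans (LP.length-map u (allFin q)) (LP.length-tabulate {n = q} id)))
           (ℕP.m<m+n (2 ℕ.^ n) (subst (0 <_) (sym (cong (ℕ._+ 0) e)) (s≤s z≤n)))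

module Characters where

  open import Defs hiding (q; u; tr)
  open FiniteField using (module Properties)
  open import Data.Nat using (ℕ; zero; suc)
  open import Data.Fin as Fin using (Fin)
  import Data.Fin.Properties as FinP
  open import Data.Bool using (Bool; true; false; _xor_)
  open import Data.List using (map; allFin; tabulate)
  import Data.List.Properties as LP
  open import Data.Product using (proj₁; proj₂)
  open import Function using (_∘_; id)
  open import Relation.Binary.PropositionalEquality
  import Data.Integer as ℤ
  open ℤ using (ℤ; -[1+_]) renaming (+_ to pos)
  import Data.Integer.Properties as ℤP
  open import Data.Integer.Tactic.RingSolver using (solve-∀)
  import Algebra.Properties.CommutativeMonoid.Sum as CommutativeMonoidSum
  import Algebra.Properties.Semiring.Sum as SemiringSum

  module ℤ∑ = CommutativeMonoidSum ℤP.+-0-commutativeMonoid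
  module ℤ∑* = SemiringSum ℤP.+-*-semiring

  sumℤ-allFin : ∀ {N} (g : Fin N → ℤ) → sumℤ (map g (allFin N)) ≡ ℤ∑.sum g
  sumℤ-allFin {N} g = trans (cong sumℤ (LP.map-tabulate {n = N} id g)) (sumℤ-tabulate g)
    where
    sumℤ-tabulate : ∀ {N} (g : Fin N → ℤ) → sumℤ (tabulate g) ≡ ℤ∑.sum g
    sumℤ-tabulate {zero}  g = refl
    sumℤ-tabulate {suc N} g = cong (λ s → g Fin.zero ℤ.+ s) (sumℤ-tabulate (g ∘ Fin.suc))

  ℤ∑-const : ∀ {N} c → ℤ∑.sum {N} (λ _ → c) ≡ pos N ℤ.* c
  ℤ∑-const {zero}  c = sym (ℤP.*-zeroˡ c)
  ℤ∑-const {suc N} c = trans (cong (λ s → c ℤ.+ s) (ℤ∑-const {N} c)) (c+N*c≡[1+N]*c (pos N) c)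
    where
    c+N*c≡[1+N]*c : ∀ a c → c ℤ.+ a ℤ.* c ≡ (pos 1 ℤ.+ a) ℤ.* c
    c+N*c≡[1+N]*c = solve-∀

  ℤ∑-single : ∀ {N} (t : Fin N → ℤ) i → (∀ j → j ≢ i → t j ≡ pos 0) → ℤ∑.sum t ≡ t i
  ℤ∑-single {suc N} t Fin.zero    t≡0 = trans (cong (λ s → t Fin.zero ℤ.+ s) rest≡0) (ℤP.+-identityʳ _)
    where
    rest≡0 : ℤ∑.sum (t ∘ Fin.suc) ≡ pos 0
    rest≡0 = trans (ℤ∑.sum-cong-≗ {y = λ _ → pos 0} (λ j → t≡0 (Fin.suc j) λ ()))
                   (trans (ℤ∑-const {N} (pos 0)) (ℤP.*-zeroʳ (pos N)))
  ℤ∑-single {suc N} t (Fin.suc i) t≡0 = trans (cong (ℤ._+ ℤ∑.sum (t ∘ Fin.suc)) (t≡0 Fin.zero λ ()))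
    (trans (ℤP.+-identityˡ _) (ℤ∑-single (t ∘ Fin.suc) i (λ j j≢i → t≡0 (Fin.suc j) (j≢i ∘ FinP.suc-injective))))

  sign-xor : ∀ a b → sign (a xor b) ≡ sign a ℤ.* sign b
  sign-xor true  true  = refl
  sign-xor true  false = refl
  sign-xor false true  = refl
  sign-xor false false = refl

  sign*sign≡1 : ∀ a → sign a ℤ.* sign a ≡ pos 1
  sign*sign≡1 true  = refl
  sign*sign≡1 false = refl

  x≡-x⇒x≡0 : ∀ x → x ≡ ℤ.- x → x ≡ pos 0
  x≡-x⇒x≡0 (pos zero)    _ = refl
  x≡-x⇒x≡0 (pos (suc n)) ()
  x≡-x⇒x≡0 -[1+ n ]      ()

  module CharacterSums {n : ℕ} (K : GF2^ (suc n)) where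
    open Properties K public
    open ≡-Reasoning

    ∑ : (𝔽 → ℤ) → ℤ
    ∑ g = ℤ∑.sum (g ∘ u)

    ∑-cong : ∀ {g g′} → (∀ x → g x ≡ g′ x) → ∑ g ≡ ∑ g′
    ∑-cong {g} {g′} e = ℤ∑.sum-cong-≗ {x = g ∘ u} {y = g′ ∘ u} (e ∘ u)

    ∑-+ : ∀ g g′ → ∑ (λ x → g x ℤ.+ g′ x) ≡ ∑ g ℤ.+ ∑ g′
    ∑-+ g g′ = ℤ∑.∑-distrib-+ (g ∘ u) (g′ ∘ u)

    ∑-*ˡ : ∀ c g → ∑ (λ x → c ℤ.* g x) ≡ c ℤ.* ∑ g
    ∑-*ˡ c g = sym (ℤ∑*.*-distribˡ-sum c (g ∘ u))

    ∑-*ʳ : ∀ c g → ∑ (λ x → g x ℤ.* c) ≡ ∑ g ℤ.* c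
    ∑-*ʳ c g = sym (ℤ∑*.*-distribʳ-sum c (g ∘ u))

    ∑-const : ∀ c → ∑ (λ _ → c) ≡ pos q ℤ.* c
    ∑-const c = ℤ∑-const {q} c

    ∑-1 : ∑ (λ _ → pos 1) ≡ pos q
    ∑-1 = trans (∑-const (pos 1)) (ℤP.*-identityʳ (pos q))

    ∑-comm : ∀ (g : 𝔽 → 𝔽 → ℤ) → ∑ (λ x → ∑ (g x)) ≡ ∑ (λ y → ∑ (λ x → g x y))
    ∑-comm g = ℤ∑.∑-comm (λ i j → g (u i) (u j))

    ∑-single : ∀ (g : 𝔽 → ℤ) x → (∀ y → y ≢ x → g y ≡ pos 0) → ∑ g ≡ g x
    ∑-single g x g≡0 = trans (ℤ∑-single (g ∘ u) (index x) (λ j j≢ → g≡0 (u j) (λ e → j≢ (trans (sym (index∘u j)) (cong index e)))))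
                             (cong g (u∘index x))

    ∑-translate : ∀ t g → ∑ (λ x → g (x + t)) ≡ ∑ g
    ∑-translate t g = sym (trans (ℤ∑.sum-permute (g ∘ u) (permutationOf (_+ t) (_+ t) (λ x → x+y+y≡x x t) (λ x → x+y+y≡x x t)))
                                 (ℤ∑.sum-cong-≗ (λ i → cong g (u∘index (u i + t)))))

    χ : 𝔽 → ℤ
    χ z = sign (tr z)

    χ-+ : ∀ a b → χ (a + b) ≡ χ a ℤ.* χ b
    χ-+ a b = trans (cong sign (tr-+ a b)) (sign-xor (tr a) (tr b))

    χ-*-+ : ∀ w y x → χ (w * y) ℤ.* χ (w * x) ≡ χ (w * (y + x))
    χ-*-+ w y x = trans (sym (χ-+ (w * y) (w * x))) (cong χ (sym (distribˡ w y x)))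

    ∑χ : 𝔽 → ℤ
    ∑χ z = ∑ (λ w → χ (w * z))

    ∑χ-0 : ∑χ 0# ≡ pos q
    ∑χ-0 = trans (∑-cong (λ w → cong sign (trans (cong tr (zeroʳ w)) tr-0))) ∑-1

    -- translating w by t with tr (t * z) = 1 flips the sign of every term
    ∑χ-nonzero : ∀ z → z ≢ 0# → ∑χ z ≡ pos 0
    ∑χ-nonzero z z≢0 = x≡-x⇒x≡0 (∑χ z) (begin
      ∑χ z                                   ≡⟨ sym (∑-translate t (λ w → χ (w * z))) ⟩
      ∑ (λ w → χ ((w + t) * z))              ≡⟨ ∑-cong (λ w → trans (cong χ (distribʳ z w t)) (χ-+ (w * z) (t * z))) ⟩
      ∑ (λ w → χ (w * z) ℤ.* χ (t * z))      ≡⟨ ∑-*ʳ (χ (t * z)) (λ w → χ (w * z)) ⟩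
      ∑χ z ℤ.* χ (t * z)                     ≡⟨ cong (λ v → ∑χ z ℤ.* sign (tr v)) t*z≡y ⟩
      ∑χ z ℤ.* sign (tr y)                   ≡⟨ cong (λ b → ∑χ z ℤ.* sign b) (proj₂ ∃tr≡true) ⟩
      ∑χ z ℤ.* ℤ.- pos 1                     ≡⟨ x*-1≡-x (∑χ z) ⟩
      ℤ.- ∑χ z                               ∎)
      where
      y = proj₁ ∃tr≡true
      t = y * inv z z≢0
      t*z≡y : t * z ≡ y
      t*z≡y = trans (*-assoc y _ z) (trans (cong (y *_) (trans (*-comm _ z) (inv-inverseʳ z z≢0))) (*-identityʳ y))
      x*-1≡-x : ∀ x → x ℤ.* ℤ.- pos 1 ≡ ℤ.- x
      x*-1≡-x = solve-∀

    ∑χ-≢ : ∀ y x → y ≢ x → ∑χ (y + x) ≡ pos 0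
    ∑χ-≢ y x y≢x = ∑χ-nonzero (y + x) (y≢x ∘ x+y≡0⇒x≡y y x)

    fourier-inversion : ∀ (g : 𝔽 → ℤ) x → ∑ (λ w → ∑ (λ y → g y ℤ.* χ (w * y)) ℤ.* χ (w * x)) ≡ pos q ℤ.* g x
    fourier-inversion g x = begin
      ∑ (λ w → ∑ (λ y → g y ℤ.* χ (w * y)) ℤ.* χ (w * x))   ≡⟨ ∑-cong (λ w → sym (∑-*ʳ (χ (w * x)) (λ y → g y ℤ.* χ (w * y)))) ⟩
      ∑ (λ w → ∑ (λ y → g y ℤ.* χ (w * y) ℤ.* χ (w * x)))   ≡⟨ ∑-cong (λ w → ∑-cong (λ y → trans (ℤP.*-assoc (g y) (χ (w * y)) (χ (w * x))) (cong (g y ℤ.*_) (χ-*-+ w y x)))) ⟩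
      ∑ (λ w → ∑ (λ y → g y ℤ.* χ (w * (y + x))))           ≡⟨ ∑-comm (λ w y → g y ℤ.* χ (w * (y + x))) ⟩
      ∑ (λ y → ∑ (λ w → g y ℤ.* χ (w * (y + x))))           ≡⟨ ∑-cong (λ y → ∑-*ˡ (g y) (λ w → χ (w * (y + x)))) ⟩
      ∑ (λ y → g y ℤ.* ∑χ (y + x))                          ≡⟨ ∑-single _ x (λ y y≢x → trans (cong (g y ℤ.*_) (∑χ-≢ y x y≢x)) (ℤP.*-zeroʳ (g y))) ⟩
      g x ℤ.* ∑χ (x + x)                                    ≡⟨ cong (λ z → g x ℤ.* ∑χ z) (x+x≡0 x) ⟩
      g x ℤ.* ∑χ 0#                                         ≡⟨ cong (g x ℤ.*_) ∑χ-0 ⟩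
      g x ℤ.* pos q                                         ≡⟨ ℤP.*-comm (g x) (pos q) ⟩
      pos q ℤ.* g x                                         ∎

    W : (𝔽 → Bool) → 𝔽 → ℤ
    W g w = ∑ (λ x → sign (g x xor tr (w * x)))

    walsh≡W : ∀ g w → walsh K g w ≡ W g w
    walsh≡W g w = sumℤ-allFin (λ i → sign (g (u i) xor tr (w * u i)))

    W≡∑sign*χ : ∀ g w → W g w ≡ ∑ (λ y → sign (g y) ℤ.* χ (w * y))
    W≡∑sign*χ g w = ∑-cong (λ y → sign-xor (g y) (tr (w * y)))

    W-cong : ∀ {g g′} → (∀ x → g x ≡ g′ x) → ∀ w → W g w ≡ W g′ w
    W-cong e w = ∑-cong (λ x → cong (λ b → sign (b xor tr (w * x))) (e x))

    W-inversion : ∀ g x → ∑ (λ w → W g w ℤ.* χ (w * x)) ≡ pos q ℤ.* sign (g x)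
    W-inversion g x = trans (∑-cong (λ w → cong (ℤ._* χ (w * x)) (W≡∑sign*χ g w))) (fourier-inversion (sign ∘ g) x)

    W-shifted-inversion : ∀ g w₁ y → ∑ (λ w → W g (w + w₁) ℤ.* χ (w * y)) ≡ χ (w₁ * y) ℤ.* (pos q ℤ.* sign (g y))
    W-shifted-inversion g w₁ y = begin
      ∑ (λ w → W g (w + w₁) ℤ.* χ (w * y))                  ≡⟨ ∑-cong (λ w → cong (λ v → W g (w + w₁) ℤ.* χ (v * y)) (sym (x+y+y≡x w w₁))) ⟩
      ∑ (λ w → W g (w + w₁) ℤ.* χ ((w + w₁ + w₁) * y))      ≡⟨ ∑-translate w₁ (λ w → W g w ℤ.* χ ((w + w₁) * y)) ⟩
      ∑ (λ w → W g w ℤ.* χ ((w + w₁) * y))                  ≡⟨ ∑-cong (λ w → trans (cong (λ v → W g w ℤ.* χ v) (distribʳ y w w₁))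
                                                                (trans (cong (W g w ℤ.*_) (χ-+ (w * y) (w₁ * y))) (sym (ℤP.*-assoc (W g w) (χ (w * y)) (χ (w₁ * y)))))) ⟩
      ∑ (λ w → W g w ℤ.* χ (w * y) ℤ.* χ (w₁ * y))          ≡⟨ ∑-*ʳ (χ (w₁ * y)) (λ w → W g w ℤ.* χ (w * y)) ⟩
      ∑ (λ w → W g w ℤ.* χ (w * y)) ℤ.* χ (w₁ * y)          ≡⟨ cong (ℤ._* χ (w₁ * y)) (W-inversion g y) ⟩
      pos q ℤ.* sign (g y) ℤ.* χ (w₁ * y)                   ≡⟨ ℤP.*-comm _ (χ (w₁ * y)) ⟩
      χ (w₁ * y) ℤ.* (pos q ℤ.* sign (g y))                 ∎

    W-convolution : ∀ g h w₁ → ∑ (λ w → W g (w + w₁) ℤ.* W h w) ≡ pos q ℤ.* W (λ x → g x xor h x) w₁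
    W-convolution g h w₁ = begin
      ∑ (λ w → W g (w + w₁) ℤ.* W h w)                                        ≡⟨ ∑-cong (λ w → cong (W g (w + w₁) ℤ.*_) (W≡∑sign*χ h w)) ⟩
      ∑ (λ w → W g (w + w₁) ℤ.* ∑ (λ y → sign (h y) ℤ.* χ (w * y)))           ≡⟨ ∑-cong (λ w → sym (∑-*ˡ (W g (w + w₁)) (λ y → sign (h y) ℤ.* χ (w * y)))) ⟩
      ∑ (λ w → ∑ (λ y → W g (w + w₁) ℤ.* (sign (h y) ℤ.* χ (w * y))))         ≡⟨ ∑-cong (λ w → ∑-cong (λ y → a*[b*c]≡b*[a*c] (W g (w + w₁)) (sign (h y)) (χ (w * y)))) ⟩
      ∑ (λ w → ∑ (λ y → sign (h y) ℤ.* (W g (w + w₁) ℤ.* χ (w * y))))         ≡⟨ ∑-comm (λ w y → sign (h y) ℤ.* (W g (w + w₁) ℤ.* χ (w * y))) ⟩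
      ∑ (λ y → ∑ (λ w → sign (h y) ℤ.* (W g (w + w₁) ℤ.* χ (w * y))))         ≡⟨ ∑-cong (λ y → ∑-*ˡ (sign (h y)) (λ w → W g (w + w₁) ℤ.* χ (w * y))) ⟩
      ∑ (λ y → sign (h y) ℤ.* ∑ (λ w → W g (w + w₁) ℤ.* χ (w * y)))           ≡⟨ ∑-cong (λ y → cong (sign (h y) ℤ.*_) (W-shifted-inversion g w₁ y)) ⟩
      ∑ (λ y → sign (h y) ℤ.* (χ (w₁ * y) ℤ.* (pos q ℤ.* sign (g y))))        ≡⟨ ∑-cong (λ y → trans (regroup (sign (h y)) (χ (w₁ * y)) (pos q) (sign (g y)))
                                                                                   (cong (λ v → pos q ℤ.* (v ℤ.* χ (w₁ * y))) (sym (sign-xor (g y) (h y))))) ⟩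
      ∑ (λ y → pos q ℤ.* (sign (g y xor h y) ℤ.* χ (w₁ * y)))                 ≡⟨ ∑-*ˡ (pos q) (λ y → sign (g y xor h y) ℤ.* χ (w₁ * y)) ⟩
      pos q ℤ.* ∑ (λ y → sign (g y xor h y) ℤ.* χ (w₁ * y))                   ≡⟨ cong (pos q ℤ.*_) (sym (W≡∑sign*χ (λ x → g x xor h x) w₁)) ⟩
      pos q ℤ.* W (λ x → g x xor h x) w₁                                      ∎
      where
      a*[b*c]≡b*[a*c] : ∀ a b c → a ℤ.* (b ℤ.* c) ≡ b ℤ.* (a ℤ.* c)
      a*[b*c]≡b*[a*c] = solve-∀
      regroup : ∀ a b c d → a ℤ.* (b ℤ.* (c ℤ.* d)) ≡ c ℤ.* (d ℤ.* a ℤ.* b)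
      regroup = solve-∀

module Codes where

  open import Defs hiding (q; u; tr)
  open Characters using (module CharacterSums)
  open import Data.Nat using (ℕ; zero; suc)
  open import Data.Fin as Fin using (Fin)
  import Data.Fin.Properties as FinP
  open import Data.Bool using (Bool; true; false; not; _xor_; _∧_)
  open import Data.Fin.Subset using (∁)
  import Data.Bool.Properties as BP
  open import Data.List as L using (List; []; _∷_; map; foldr; allFin)
  import Data.List.Properties as LP
  open import Data.Vec as V using (Vec; tabulate; zipWith; replicate)
  import Data.Vec.Properties as VP
  open import Data.Product using (∃-syntax; _,_)
  open import Data.Sum using (_⊎_; inj₁; inj₂)
  open import Function using (_∘_; id)
  open import Algebra.Bundles using (CommutativeRing)
  open import Algebra.Properties.CommutativeSemigroup
    (CommutativeRing.+-commutativeSemigroup BP.xor-∧-commutativeRing) using () renaming (interchange to xor-interchange)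
  open import Relation.Binary.PropositionalEquality
  open import Relation.Nullary using (does)

  zipWith-tabulate : ∀ {N} {A B D : Set} (f : A → B → D) (g : Fin N → A) (h : Fin N → B) →
    zipWith f (tabulate g) (tabulate h) ≡ tabulate (λ i → f (g i) (h i))
  zipWith-tabulate {zero}  f g h = refl
  zipWith-tabulate {suc N} f g h = cong (f (g Fin.zero) (h Fin.zero) V.∷_) (zipWith-tabulate f (g ∘ Fin.suc) (h ∘ Fin.suc))

  replicate≡tabulate : ∀ {N} {A : Set} (a : A) → replicate N a ≡ tabulate (λ _ → a)
  replicate≡tabulate {zero}  a = refl
  replicate≡tabulate {suc N} a = cong (a V.∷_) (replicate≡tabulate a)

  module Lincomb {ℓ : ℕ} {A : Set} (F : Fin ℓ → A → Bool) where
    private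
      lincombOver : List (Fin ℓ) → (Fin ℓ → Bool) → A → Bool
      lincombOver js a x = foldr _xor_ false (map (λ j → a j ∧ F j x) js)

      lincombOver-xor : ∀ js a a′ x → lincombOver js (λ j → a j xor a′ j) x ≡ lincombOver js a x xor lincombOver js a′ x
      lincombOver-xor []       a a′ x = refl
      lincombOver-xor (j ∷ js) a a′ x =
        trans (cong₂ _xor_ (BP.∧-distribʳ-xor (F j x) (a j) (a′ j)) (lincombOver-xor js a a′ x))
              (xor-interchange (a j ∧ F j x) (a′ j ∧ F j x) _ _)

      lincombOver-cong : ∀ js {a a′} x → (∀ j → a j ≡ a′ j) → lincombOver js a x ≡ lincombOver js a′ x
      lincombOver-cong []       x e = refl
      lincombOver-cong (j ∷ js) x e = cong₂ _xor_ (cong (_∧ F j x) (e j)) (lincombOver-cong js x e)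

    lincomb-xor : ∀ a a′ x → lincomb (λ j → a j xor a′ j) F x ≡ lincomb a F x xor lincomb a′ F x
    lincomb-xor = lincombOver-xor (allFin ℓ)

    lincomb-cong : ∀ {a a′} x → (∀ j → a j ≡ a′ j) → lincomb a F x ≡ lincomb a′ F x
    lincomb-cong = lincombOver-cong (allFin ℓ)

    lincomb-zero : ∀ {a} x → (∀ j → a j ≡ false) → lincomb a F x ≡ false
    lincomb-zero x a≡0 = trans (lincombOver-cong (allFin ℓ) {a′ = λ _ → false} x a≡0) (allFalse (allFin ℓ))
      where
      allFalse : ∀ js → lincombOver js (λ _ → false) x ≡ false
      allFalse []       = refl
      allFalse (j ∷ js) = allFalse js

    lincomb-unit : ∀ j x → lincomb (λ i → does (i FinP.≟ j)) F x ≡ F j x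
    lincomb-unit j x = trans (cong (foldr _xor_ false) (LP.map-tabulate {n = ℓ} id _)) (unit ℓ (λ i → F i x) j)
      where
      zeros : ∀ k → foldr _xor_ false (L.tabulate {n = k} (λ _ → false)) ≡ false
      zeros zero    = refl
      zeros (suc k) = zeros k
      unit : ∀ ℓ (G : Fin ℓ → Bool) j → foldr _xor_ false (L.tabulate (λ i → does (i FinP.≟ j) ∧ G i)) ≡ G j
      unit (suc ℓ) G Fin.zero    = trans (cong (G Fin.zero xor_) (zeros ℓ)) (BP.xor-identityʳ _)
      unit (suc ℓ) G (Fin.suc j) = unit ℓ (G ∘ Fin.suc) j

  module Codewords {n : ℕ} (K : GF2^ (suc n)) {ℓ : ℕ} (F : Fin ℓ → Carrier K → Bool) where
    open CharacterSums K public
    open Lincomb F public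

    f⟨_⟩ : (Fin ℓ → Bool) → 𝔽 → Bool
    f⟨ a ⟩ = lincomb a F

    word : (Fin ℓ → Bool) → 𝔽 → Bool → 𝔽 → Bool
    word a b c x = (f⟨ a ⟩ x xor tr (b * x)) xor c

    codeword : (Fin ℓ → Bool) → 𝔽 → Bool → Vec Bool q
    codeword a b c = tabulate (word a b c ∘ u)

    Generator : Vec Bool q → Set
    Generator v = InRM1 K v ⊎ ∃[ j ] (v ≡ truthTable K (F j))

    zeroVec≡tabulate : zeroVec ≡ tabulate {n = q} (λ _ → false)
    zeroVec≡tabulate = replicate≡tabulate false

    span-f : ∀ a → Span Generator (tabulate (f⟨ a ⟩ ∘ u))
    span-f a = spanOver (allFin ℓ)
      where
      spanTerm : ∀ (aj : Bool) j → Span Generator (tabulate (λ i → aj ∧ F j (u i)))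
      spanTerm true  j = span-gen (inj₂ (j , refl))
      spanTerm false j = subst (Span Generator) zeroVec≡tabulate span-zero
      spanOver : ∀ js → Span Generator (tabulate (λ i → foldr _xor_ false (map (λ j → a j ∧ F j (u i)) js)))
      spanOver []       = subst (Span Generator) zeroVec≡tabulate span-zero
      spanOver (j ∷ js) = subst (Span Generator) (zipWith-tabulate _xor_ _ _) (span-add (spanTerm (a j) j) (spanOver js))

    codeword-inCode : ∀ a b c → InCode K F (codeword a b c)
    codeword-inCode a b c = subst (InCode K F)
      (trans (zipWith-tabulate _xor_ _ _) (VP.tabulate-cong (λ i → sym (BP.xor-assoc (f⟨ a ⟩ (u i)) (tr (b * u i)) c))))
      (span-add (span-f a) (span-gen (inj₁ (b , c , refl))))

    word-xor : ∀ a b c a′ b′ c′ x → word a b c x xor word a′ b′ c′ x ≡ word (λ j → a j xor a′ j) (b + b′) (c xor c′) x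
    word-xor a b c a′ b′ c′ x = begin
      ((f⟨ a ⟩ x xor tr (b * x)) xor c) xor ((f⟨ a′ ⟩ x xor tr (b′ * x)) xor c′)          ≡⟨ xor-interchange (f⟨ a ⟩ x xor tr (b * x)) c (f⟨ a′ ⟩ x xor tr (b′ * x)) c′ ⟩
      ((f⟨ a ⟩ x xor tr (b * x)) xor (f⟨ a′ ⟩ x xor tr (b′ * x))) xor (c xor c′)          ≡⟨ cong (_xor (c xor c′)) (xor-interchange (f⟨ a ⟩ x) (tr (b * x)) (f⟨ a′ ⟩ x) (tr (b′ * x))) ⟩
      ((f⟨ a ⟩ x xor f⟨ a′ ⟩ x) xor (tr (b * x) xor tr (b′ * x))) xor (c xor c′)          ≡⟨ cong₂ (λ s t → (s xor t) xor (c xor c′)) (sym (lincomb-xor a a′ x))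
                                                                                             (sym (trans (cong tr (distribʳ x b b′)) (tr-+ (b * x) (b′ * x)))) ⟩
      (f⟨ (λ j → a j xor a′ j) ⟩ x xor tr ((b + b′) * x)) xor (c xor c′)                  ∎
      where open ≡-Reasoning

    codeword-⊕ : ∀ a b c a′ b′ c′ → codeword a b c ⊕ codeword a′ b′ c′ ≡ codeword (λ j → a j xor a′ j) (b + b′) (c xor c′)
    codeword-⊕ a b c a′ b′ c′ = trans (zipWith-tabulate _xor_ _ _) (VP.tabulate-cong λ i → word-xor a b c a′ b′ c′ (u i))

    inCode⇒codeword : ∀ {v} → InCode K F v → ∃[ a ] ∃[ b ] ∃[ c ] (v ≡ codeword a b c)
    inCode⇒codeword span-zero = (λ _ → false) , 0# , false , trans zeroVec≡tabulate (VP.tabulate-cong λ i → sym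
      (trans (BP.xor-identityʳ _) (cong₂ _xor_ (lincomb-zero (u i) (λ _ → refl)) (trans (cong tr (zeroˡ (u i))) tr-0))))
    inCode⇒codeword (span-gen (inj₁ (b , c , e))) = (λ _ → false) , b , c , trans e (VP.tabulate-cong λ i →
      cong (λ z → (z xor tr (b * u i)) xor c) (sym (lincomb-zero (u i) (λ _ → refl))))
    inCode⇒codeword (span-gen (inj₂ (j , e))) = (λ i → does (i FinP.≟ j)) , 0# , false , trans e (VP.tabulate-cong λ i → sym
      (trans (BP.xor-identityʳ _) (trans (cong₂ _xor_ (lincomb-unit j (u i)) (trans (cong tr (zeroˡ (u i))) tr-0)) (BP.xor-identityʳ _))))
    inCode⇒codeword (span-add s s′) with inCode⇒codeword s | inCode⇒codeword s′
    ... | a , b , c , refl | a′ , b′ , c′ , refl = _ , _ , _ , codeword-⊕ a b c a′ b′ c′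

    codeword-cong : ∀ {a a′} → (∀ j → a j ≡ a′ j) → ∀ b c → codeword a b c ≡ codeword a′ b c
    codeword-cong a≡a′ b c = VP.tabulate-cong (λ i → cong (λ z → (z xor tr (b * u i)) xor c) (lincomb-cong (u i) a≡a′))

    ∁-codeword : ∀ a b c → ∁ (codeword a b c) ≡ codeword a b (not c)
    ∁-codeword a b c = trans (sym (VP.tabulate-∘ not (word a b c ∘ u)))
      (VP.tabulate-cong (λ i → BP.not-distribʳ-xor (f⟨ a ⟩ (u i) xor tr (b * u i)) c))

module Counting where

  open import Defs using (HasCount)
  open import Data.Nat as ℕ using (ℕ; zero; suc)
  import Data.Nat.Properties as ℕP
  open import Data.Bool using (Bool; true; false)
  open import Data.List using (List; []; _∷_; map; length; _++_; cartesianProduct; filter)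
  open import Data.Nat.ListAction using (sum)
  open import Data.Nat.ListAction.Properties using (sum-++)
  import Data.List.Properties as LP
  open import Data.List.Membership.Propositional using (_∈_)
  open import Data.List.Membership.Propositional.Properties using (∈-map⁺; ∈-map⁻; ∈-++⁺ˡ; ∈-++⁺ʳ; ∈-filter⁺; ∈-filter⁻)
  open import Data.List.Relation.Unary.Any using (here; there)
  open import Data.List.Relation.Unary.All using (All; []; _∷_)
  open import Data.List.Relation.Unary.Unique.Propositional using (Unique; []; _∷_)
  import Data.List.Relation.Unary.Unique.Propositional.Properties as Unique
  open import Data.Vec as V using (Vec)
  open import Data.Product using (_×_; _,_)
  open import Data.Empty using (⊥)
  open import Function using (_∘_; mk⇔; _⇔_)
  open import Relation.Binary.PropositionalEquality
  open import Relation.Nullary using (yes; no; does)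
  open import Relation.Unary using (Pred; Decidable)
  open import Level using (0ℓ)

  𝟙 : Bool → ℕ
  𝟙 true  = 1
  𝟙 false = 0

  length-filter≡sum𝟙 : ∀ {A : Set} {P : Pred A 0ℓ} (P? : Decidable P) xs → length (filter P? xs) ≡ sum (map (𝟙 ∘ does ∘ P?) xs)
  length-filter≡sum𝟙 P? []       = refl
  length-filter≡sum𝟙 P? (x ∷ xs) with P? x
  ... | yes _ = cong suc (length-filter≡sum𝟙 P? xs)
  ... | no  _ = length-filter≡sum𝟙 P? xs

  sum-map-cong : ∀ {A : Set} {f g : A → ℕ} xs → (∀ x → x ∈ xs → f x ≡ g x) → sum (map f xs) ≡ sum (map g xs)
  sum-map-cong []       e = refl
  sum-map-cong (x ∷ xs) e = cong₂ ℕ._+_ (e x (here refl)) (sum-map-cong xs (λ y y∈ → e y (there y∈)))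

  sum-map-const : ∀ {A : Set} c (xs : List A) → sum (map (λ _ → c) xs) ≡ length xs ℕ.* c
  sum-map-const c []       = refl
  sum-map-const c (x ∷ xs) = cong (c ℕ.+_) (sum-map-const c xs)

  sum-cartesianProduct : ∀ {A B : Set} (f : A × B → ℕ) xs ys →
    sum (map f (cartesianProduct xs ys)) ≡ sum (map (λ x → sum (map (λ y → f (x , y)) ys)) xs)
  sum-cartesianProduct f []       ys = refl
  sum-cartesianProduct f (x ∷ xs) ys = begin
    sum (map f (map (x ,_) ys ++ cartesianProduct xs ys))                   ≡⟨ cong sum (LP.map-++ f (map (x ,_) ys) _) ⟩
    sum (map f (map (x ,_) ys) ++ map f (cartesianProduct xs ys))           ≡⟨ sum-++ (map f (map (x ,_) ys)) _ ⟩
    sum (map f (map (x ,_) ys)) ℕ.+ sum (map f (cartesianProduct xs ys))    ≡⟨ cong₂ ℕ._+_ (cong sum (sym (LP.map-∘ ys))) (sum-cartesianProduct f xs ys) ⟩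
    sum (map (λ y → f (x , y)) ys) ℕ.+ sum (map (λ x → sum (map (λ y → f (x , y)) ys)) xs) ∎
    where open ≡-Reasoning

  sum-map-single : ∀ {A : Set} (f : A → ℕ) c a xs → Unique xs → a ∈ xs → (∀ x → x ∈ xs → x ≢ a → f x ≡ c) →
    sum (map f xs) ℕ.+ c ≡ f a ℕ.+ length xs ℕ.* c
  sum-map-single f c a (x ∷ xs) (x∉xs ∷ unique) (here refl) f≡c = begin
    f x ℕ.+ sum (map f xs) ℕ.+ c          ≡⟨ ℕP.+-assoc (f x) _ c ⟩
    f x ℕ.+ (sum (map f xs) ℕ.+ c)        ≡⟨ cong (λ z → f x ℕ.+ (z ℕ.+ c)) (trans (sum-map-cong xs (λ y y∈ → f≡c y (there y∈) (x≢ x∉xs y∈ ∘ sym)))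
                                                                                 (sum-map-const c xs)) ⟩
    f x ℕ.+ (length xs ℕ.* c ℕ.+ c)       ≡⟨ cong (f x ℕ.+_) (ℕP.+-comm (length xs ℕ.* c) c) ⟩
    f x ℕ.+ (c ℕ.+ length xs ℕ.* c)       ∎
    where
    open ≡-Reasoning
    x≢ : ∀ {ys y} → All (x ≢_) ys → y ∈ ys → x ≢ y
    x≢ (x≢y ∷ _)   (here refl) = x≢y
    x≢ (_ ∷ x≢ys) (there y∈)  = x≢ x≢ys y∈
  sum-map-single f c a (x ∷ xs) (x∉xs ∷ unique) (there a∈) f≡c = begin
    f x ℕ.+ sum (map f xs) ℕ.+ c          ≡⟨ ℕP.+-assoc (f x) _ c ⟩
    f x ℕ.+ (sum (map f xs) ℕ.+ c)        ≡⟨ cong (f x ℕ.+_) (sum-map-single f c a xs unique a∈ (λ y y∈ → f≡c y (there y∈))) ⟩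
    f x ℕ.+ (f a ℕ.+ length xs ℕ.* c)     ≡⟨ cong (ℕ._+ (f a ℕ.+ length xs ℕ.* c)) (f≡c x (here refl) (x≢a x∉xs a∈)) ⟩
    c ℕ.+ (f a ℕ.+ length xs ℕ.* c)       ≡⟨ sym (ℕP.+-assoc c (f a) _) ⟩
    c ℕ.+ f a ℕ.+ length xs ℕ.* c         ≡⟨ cong (ℕ._+ length xs ℕ.* c) (ℕP.+-comm c (f a)) ⟩
    f a ℕ.+ c ℕ.+ length xs ℕ.* c         ≡⟨ ℕP.+-assoc (f a) c _ ⟩
    f a ℕ.+ (c ℕ.+ length xs ℕ.* c)       ∎
    where
    open ≡-Reasoning
    x≢a : ∀ {ys} → All (x ≢_) ys → a ∈ ys → x ≢ a
    x≢a (x≢y ∷ _)   (here refl) = x≢y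
    x≢a (_ ∷ x≢ys) (there a∈)  = x≢a x≢ys a∈

  map-unique : ∀ {A B : Set} (f : A → B) xs → (∀ {x y} → x ∈ xs → y ∈ xs → f x ≡ f y → x ≡ y) → Unique xs → Unique (map f xs)
  map-unique f []       injective []                = []
  map-unique f (x ∷ xs) injective (x∉xs ∷ unique) =
    fx∉ xs x∉xs (λ y∈ → y∈) ∷ map-unique f xs (λ x∈ y∈ → injective (there x∈) (there y∈)) unique
    where
    fx∉ : ∀ ys → All (x ≢_) ys → (∀ {y} → y ∈ ys → y ∈ xs) → All (f x ≢_) (map f ys)
    fx∉ []       []           _   = []
    fx∉ (y ∷ ys) (x≢y ∷ x≢ys) ⊆xs = (x≢y ∘ injective (here refl) (there (⊆xs (here refl)))) ∷ fx∉ ys x≢ys (⊆xs ∘ there)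

  allVecs : ∀ k → List (Vec Bool k)
  allVecs zero    = V.[] ∷ []
  allVecs (suc k) = map (true V.∷_) (allVecs k) ++ map (false V.∷_) (allVecs k)

  ∈-allVecs : ∀ {k} (v : Vec Bool k) → v ∈ allVecs k
  ∈-allVecs V.[]                 = here refl
  ∈-allVecs (true V.∷ v)         = ∈-++⁺ˡ (∈-map⁺ (true V.∷_) (∈-allVecs v))
  ∈-allVecs {suc k} (false V.∷ v) = ∈-++⁺ʳ (map (true V.∷_) (allVecs k)) (∈-map⁺ (false V.∷_) (∈-allVecs v))

  length-allVecs : ∀ k → length (allVecs k) ≡ 2 ℕ.^ k
  length-allVecs zero    = refl
  length-allVecs (suc k) = begin
    length (map (true V.∷_) (allVecs k) ++ map (false V.∷_) (allVecs k))    ≡⟨ LP.length-++ (map (true V.∷_) (allVecs k)) ⟩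
    length (map (true V.∷_) (allVecs k)) ℕ.+ length (map (false V.∷_) (allVecs k))
                                                                            ≡⟨ cong₂ ℕ._+_ (length-half true) (length-half false) ⟩
    2 ℕ.^ k ℕ.+ 2 ℕ.^ k                                                     ≡⟨ cong (2 ℕ.^ k ℕ.+_) (sym (ℕP.+-identityʳ _)) ⟩
    2 ℕ.^ suc k                                                             ∎
    where
    open ≡-Reasoning
    length-half : ∀ x → length (map (x V.∷_) (allVecs k)) ≡ 2 ℕ.^ k
    length-half x = trans (LP.length-map _ (allVecs k)) (length-allVecs k)

  allVecs-unique : ∀ k → Unique (allVecs k)
  allVecs-unique zero    = [] ∷ []
  allVecs-unique (suc k) = Unique.++⁺ (Unique.map⁺ ∷-injectiveʳ (allVecs-unique k)) (Unique.map⁺ ∷-injectiveʳ (allVecs-unique k)) disjoint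
    where
    ∷-injectiveʳ : ∀ {x} {v w : Vec Bool k} → x V.∷ v ≡ x V.∷ w → v ≡ w
    ∷-injectiveʳ refl = refl
    disjoint : ∀ {v} → v ∈ map (true V.∷_) (allVecs k) × v ∈ map (false V.∷_) (allVecs k) → ⊥
    disjoint (v∈ , v∈′) with ∈-map⁻ (true V.∷_) v∈ | ∈-map⁻ (false V.∷_) v∈′
    ... | _ , _ , refl | _ , _ , ()

  hasCount-filter : ∀ {k} {Blk : Vec Bool k → Set} (L : List (Vec Bool k)) → Unique L → (∀ B → B ∈ L ⇔ Blk B) →
    ∀ {P : Pred (Vec Bool k) 0ℓ} (P? : Decidable P) → HasCount (λ B → Blk B × P B) (length (filter P? L))
  hasCount-filter L unique L⇔Blk P? = filter P? L , Unique.filter⁺ P? unique , refl ,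
    λ B → mk⇔ (λ B∈ → let (B∈L , PB) = ∈-filter⁻ P? B∈ in Equivalence.to (L⇔Blk B) B∈L , PB)
              (λ (BlkB , PB) → ∈-filter⁺ P? (Equivalence.from (L⇔Blk B) BlkB) PB)
    where open import Function.Bundles using (Equivalence)

  length-cartesianProduct : ∀ {A B : Set} (xs : List A) (ys : List B) → length (cartesianProduct xs ys) ≡ length xs ℕ.* length ys
  length-cartesianProduct []       ys = refl
  length-cartesianProduct (x ∷ xs) ys = trans (LP.length-++ (map (x ,_) ys))
    (cong₂ ℕ._+_ (LP.length-map (x ,_) ys) (length-cartesianProduct xs ys))

module Blocks where

  open import Defs hiding (q; u; tr)
  open Characters using (module ℤ∑; sign-xor)
  open Counting using (𝟙)
  open Codes using (module Codewords)
  open import Data.Nat as ℕ using (ℕ; zero; suc; z≤n; s≤s)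
  import Data.Nat.Properties as ℕP
  open import Data.Fin as Fin using (Fin)
  import Data.Fin.Properties as FinP
  open import Data.Bool using (Bool; true; false; _xor_; _∧_)
  import Data.Bool.Properties as BP
  open import Data.Vec using (Vec; tabulate; _∷_)
  import Data.Vec.Properties as VP
  open import Data.Fin.Subset using (Subset; ∣_∣; _∩_)
  open import Data.Product using (∃-syntax; _×_; _,_)
  open import Data.Empty using (⊥-elim)
  open import Function using (_∘_)
  open import Relation.Binary.PropositionalEquality
  open import Relation.Nullary using (Dec; yes; no; ¬_)
  import Data.Integer as ℤ
  open ℤ using (ℤ; -[1+_]) renaming (+_ to pos)
  import Data.Integer.Properties as ℤP
  open import Data.Integer.Tactic.RingSolver using (solve-∀)

  ∣x∷p∣ : ∀ {N} x (p : Subset N) → ∣ x ∷ p ∣ ≡ 𝟙 x ℕ.+ ∣ p ∣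
  ∣x∷p∣ true  p = refl
  ∣x∷p∣ false p = refl

  wt*2+∑sign≡N : ∀ {N} (g : Fin N → Bool) → pos ∣ tabulate g ∣ ℤ.* pos 2 ℤ.+ ℤ∑.sum (sign ∘ g) ≡ pos N
  wt*2+∑sign≡N {zero}  g = refl
  wt*2+∑sign≡N {suc N} g = begin
    pos ∣ tabulate g ∣ ℤ.* pos 2 ℤ.+ (sign g₀ ℤ.+ S)                     ≡⟨ cong (λ k → pos k ℤ.* pos 2 ℤ.+ (sign g₀ ℤ.+ S))
                                                                              (∣x∷p∣ g₀ (tabulate (g ∘ Fin.suc))) ⟩
    pos (𝟙 g₀ ℕ.+ w) ℤ.* pos 2 ℤ.+ (sign g₀ ℤ.+ S)                       ≡⟨ cong (λ k → k ℤ.* pos 2 ℤ.+ (sign g₀ ℤ.+ S)) (ℤP.pos-+ (𝟙 g₀) w) ⟩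
    (pos (𝟙 g₀) ℤ.+ pos w) ℤ.* pos 2 ℤ.+ (sign g₀ ℤ.+ S)                 ≡⟨ regroup (pos (𝟙 g₀)) (pos w) (sign g₀) S ⟩
    (pos (𝟙 g₀) ℤ.* pos 2 ℤ.+ sign g₀) ℤ.+ (pos w ℤ.* pos 2 ℤ.+ S)       ≡⟨ cong₂ ℤ._+_ (𝟙*2+sign≡1 g₀) (wt*2+∑sign≡N (g ∘ Fin.suc)) ⟩
    pos (suc N)                                                          ∎
    where
    open ≡-Reasoning
    g₀ = g Fin.zero
    w = ∣ tabulate (g ∘ Fin.suc) ∣
    S = ℤ∑.sum (sign ∘ g ∘ Fin.suc)
    regroup : ∀ c w s S → (c ℤ.+ w) ℤ.* pos 2 ℤ.+ (s ℤ.+ S) ≡ (c ℤ.* pos 2 ℤ.+ s) ℤ.+ (w ℤ.* pos 2 ℤ.+ S)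
    regroup = solve-∀
    𝟙*2+sign≡1 : ∀ x → pos (𝟙 x) ℤ.* pos 2 ℤ.+ sign x ≡ pos 1
    𝟙*2+sign≡1 true  = refl
    𝟙*2+sign≡1 false = refl

  ∣∩∣*4+∑sign≡N : ∀ {N} (g h : Fin N → Bool) →
    pos ∣ tabulate g ∩ tabulate h ∣ ℤ.* pos 4 ℤ.+ ℤ∑.sum (sign ∘ g) ℤ.+ ℤ∑.sum (sign ∘ h) ℤ.- ℤ∑.sum (λ i → sign (g i xor h i)) ≡ pos N
  ∣∩∣*4+∑sign≡N {zero}  g h = refl
  ∣∩∣*4+∑sign≡N {suc N} g h = begin
    pos ∣ tabulate g ∩ tabulate h ∣ ℤ.* pos 4 ℤ.+ (sign g₀ ℤ.+ S) ℤ.+ (sign h₀ ℤ.+ T) ℤ.- (sign (g₀ xor h₀) ℤ.+ U)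
        ≡⟨ cong (λ k → pos k ℤ.* pos 4 ℤ.+ (sign g₀ ℤ.+ S) ℤ.+ (sign h₀ ℤ.+ T) ℤ.- (sign (g₀ xor h₀) ℤ.+ U))
                (∣x∷p∣ (g₀ ∧ h₀) (tabulate (g ∘ Fin.suc) ∩ tabulate (h ∘ Fin.suc))) ⟩
    pos (𝟙 (g₀ ∧ h₀) ℕ.+ i) ℤ.* pos 4 ℤ.+ (sign g₀ ℤ.+ S) ℤ.+ (sign h₀ ℤ.+ T) ℤ.- (sign (g₀ xor h₀) ℤ.+ U)
        ≡⟨ cong (λ k → k ℤ.* pos 4 ℤ.+ (sign g₀ ℤ.+ S) ℤ.+ (sign h₀ ℤ.+ T) ℤ.- (sign (g₀ xor h₀) ℤ.+ U)) (ℤP.pos-+ (𝟙 (g₀ ∧ h₀)) i) ⟩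
    (pos (𝟙 (g₀ ∧ h₀)) ℤ.+ pos i) ℤ.* pos 4 ℤ.+ (sign g₀ ℤ.+ S) ℤ.+ (sign h₀ ℤ.+ T) ℤ.- (sign (g₀ xor h₀) ℤ.+ U)
        ≡⟨ regroup (pos (𝟙 (g₀ ∧ h₀))) (pos i) (sign g₀) S (sign h₀) T (sign (g₀ xor h₀)) U ⟩
    (pos (𝟙 (g₀ ∧ h₀)) ℤ.* pos 4 ℤ.+ sign g₀ ℤ.+ sign h₀ ℤ.- sign (g₀ xor h₀)) ℤ.+ (pos i ℤ.* pos 4 ℤ.+ S ℤ.+ T ℤ.- U)
        ≡⟨ cong₂ ℤ._+_ (pointwise g₀ h₀) (∣∩∣*4+∑sign≡N (g ∘ Fin.suc) (h ∘ Fin.suc)) ⟩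
    pos (suc N)
        ∎
    where
    open ≡-Reasoning
    g₀ = g Fin.zero
    h₀ = h Fin.zero
    i = ∣ tabulate (g ∘ Fin.suc) ∩ tabulate (h ∘ Fin.suc) ∣
    S = ℤ∑.sum (sign ∘ g ∘ Fin.suc)
    T = ℤ∑.sum (sign ∘ h ∘ Fin.suc)
    U = ℤ∑.sum (λ j → sign (g (Fin.suc j) xor h (Fin.suc j)))
    regroup : ∀ c i s S t T r U → (c ℤ.+ i) ℤ.* pos 4 ℤ.+ (s ℤ.+ S) ℤ.+ (t ℤ.+ T) ℤ.- (r ℤ.+ U)
                                 ≡ (c ℤ.* pos 4 ℤ.+ s ℤ.+ t ℤ.- r) ℤ.+ (i ℤ.* pos 4 ℤ.+ S ℤ.+ T ℤ.- U)
    regroup = solve-∀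
    pointwise : ∀ x y → pos (𝟙 (x ∧ y)) ℤ.* pos 4 ℤ.+ sign x ℤ.+ sign y ℤ.- sign (x xor y) ≡ pos 1
    pointwise true  true  = refl
    pointwise true  false = refl
    pointwise false true  = refl
    pointwise false false = refl

  +-cancel-≤ : ∀ x y s t → x ℤ.+ s ≡ y ℤ.+ t → s ℤ.≤ t → y ℤ.≤ x
  +-cancel-≤ x y s t eq s≤t = subst₂ ℤ._≤_ (z+t-t≡z y t) (z+t-t≡z x t) (ℤP.+-monoˡ-≤ (ℤ.- t) y+t≤x+t)
    where
    z+t-t≡z : ∀ z t → z ℤ.+ t ℤ.- t ≡ z
    z+t-t≡z = solve-∀
    y+t≤x+t : y ℤ.+ t ℤ.≤ x ℤ.+ t
    y+t≤x+t = subst (ℤ._≤ x ℤ.+ t) eq (ℤP.+-monoʳ-≤ x s≤t)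

  *2-cancel-≤ : ∀ x y → pos x ℤ.* pos 2 ℤ.≤ pos y ℤ.* pos 2 → x ℕ.≤ y
  *2-cancel-≤ x y le = ℕP.*-cancelʳ-≤ x y 2 (ℤP.drop‿+≤+ (subst₂ ℤ._≤_ (sym (ℤP.pos-* x 2)) (sym (ℤP.pos-* y 2)) le))

  *2-mono-≤ : ∀ x y → x ℕ.≤ y → pos x ℤ.* pos 2 ℤ.≤ pos y ℤ.* pos 2
  *2-mono-≤ x y le = subst₂ ℤ._≤_ (ℤP.pos-* x 2) (ℤP.pos-* y 2) (ℤ.+≤+ (ℕP.*-monoˡ-≤ 2 le))

  sign*≤ : ∀ x n → sign x ℤ.* pos n ℤ.≤ pos n
  sign*≤ true  n = subst (ℤ._≤ pos n) (sym (ℤP.-1*i≡-i (pos n))) ℤP.neg-≤-pos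
  sign*≤ false n = ℤP.≤-reflexive (ℤP.*-identityˡ (pos n))

  isNegative : ℤ → Bool
  isNegative (pos _)  = false
  isNegative -[1+ _ ] = true

  sign[isNegative]*∣z∣≡z : ∀ z → sign (isNegative z) ℤ.* pos ℤ.∣ z ∣ ≡ z
  sign[isNegative]*∣z∣≡z (pos n)  = ℤP.*-identityˡ (pos n)
  sign[isNegative]*∣z∣≡z -[1+ n ] = ℤP.-1*i≡-i (pos (suc n))

  module MinimumWeight (t : ℕ) (K : GF2^ (2 ℕ.* suc (suc t))) {ℓ : ℕ} (F : Fin ℓ → Carrier K → Bool)
                       (bent : IsBentVectorial (suc (suc t)) K F) where
    open Codewords K F public
    open ≡-Reasoning

    m : ℕ
    m = suc (suc t)

    M Q : ℤ
    M = pos (2 ℕ.^ m)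
    Q = pos q

    q≡2^m*2^m : q ≡ 2 ℕ.^ m ℕ.* 2 ℕ.^ m
    q≡2^m*2^m = trans (cong (2 ℕ.^_) (cong (m ℕ.+_) (ℕP.+-identityʳ m))) (ℕP.^-distribˡ-+-* 2 m m)

    Q≡M*M : Q ≡ M ℤ.* M
    Q≡M*M = trans (cong pos q≡2^m*2^m) (ℤP.pos-* (2 ℕ.^ m) (2 ℕ.^ m))

    0<M : pos 0 ℤ.< M
    0<M = ℤ.+<+ (ℕP.m^n>0 2 m)

    M<Q : M ℤ.< Q
    M<Q = ℤ.+<+ (subst (2 ℕ.^ m ℕ.<_) (sym q≡2^m*2^m)
                   (ℕP.m<m*n (2 ℕ.^ m) (2 ℕ.^ m) {{ℕP.m^n≢0 2 m}} (ℕP.^-monoʳ-≤ 2 {1} {m} (s≤s z≤n))))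

    -M<M : ℤ.- M ℤ.< M
    -M<M = ℤP.<-trans (ℤP.neg-mono-< 0<M) 0<M

    dual : (𝔽 → Bool) → 𝔽 → Bool
    dual g w = isNegative (W g w)

    Nonzero : (Fin ℓ → Bool) → Set
    Nonzero a = ∃[ j ] (a j ≡ true)

    nonzero? : ∀ a → Dec (Nonzero a)
    nonzero? a = FinP.any? (λ j → a j BP.≟ true)

    ¬nonzero⇒≡false : ∀ a → ¬ Nonzero a → ∀ j → a j ≡ false
    ¬nonzero⇒≡false a a≡0 j with a j in e
    ... | true  = ⊥-elim (a≡0 (j , e))
    ... | false = refl

    W-bent : ∀ a → Nonzero a → ∀ w → W f⟨ a ⟩ w ≡ sign (dual f⟨ a ⟩ w) ℤ.* M
    W-bent a a≢0 w = trans (sym (sign[isNegative]*∣z∣≡z (W f⟨ a ⟩ w)))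
      (cong (λ k → sign (dual f⟨ a ⟩ w) ℤ.* pos k) (trans (cong ℤ.∣_∣ (sym (walsh≡W f⟨ a ⟩ w))) (bent a a≢0 w)))

    W-zero : ∀ a → ¬ Nonzero a → ∀ b → W f⟨ a ⟩ b ≡ ∑χ b
    W-zero a a≡0 b = ∑-cong (λ x → cong sign (trans (cong (_xor tr (b * x)) (lincomb-zero x (¬nonzero⇒≡false a a≡0)))
                                                    (cong tr (*-comm b x))))

    corr : (Fin ℓ → Bool) → 𝔽 → Bool → ℤ
    corr a b c = sign c ℤ.* W f⟨ a ⟩ b

    ∑sign-word : ∀ a b c → ∑ (sign ∘ word a b c) ≡ corr a b c
    ∑sign-word a b c = begin
      ∑ (λ x → sign (word a b c x))                         ≡⟨ ∑-cong (λ x → sign-xor (f⟨ a ⟩ x xor tr (b * x)) c) ⟩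
      ∑ (λ x → sign (f⟨ a ⟩ x xor tr (b * x)) ℤ.* sign c)   ≡⟨ ∑-*ʳ (sign c) (λ x → sign (f⟨ a ⟩ x xor tr (b * x))) ⟩
      W f⟨ a ⟩ b ℤ.* sign c                                 ≡⟨ ℤP.*-comm _ (sign c) ⟩
      corr a b c                                            ∎

    wt-codeword : ∀ a b c → pos (wt (codeword a b c)) ℤ.* pos 2 ℤ.+ corr a b c ≡ Q
    wt-codeword a b c = trans (cong (λ s → pos (wt (codeword a b c)) ℤ.* pos 2 ℤ.+ s) (sym (∑sign-word a b c)))
                              (wt*2+∑sign≡N (word a b c ∘ u))

    corr-nonzero : ∀ a → Nonzero a → ∀ b c → corr a b c ≡ sign (c xor dual f⟨ a ⟩ b) ℤ.* M
    corr-nonzero a a≢0 b c = begin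
      sign c ℤ.* W f⟨ a ⟩ b                    ≡⟨ cong (sign c ℤ.*_) (W-bent a a≢0 b) ⟩
      sign c ℤ.* (sign (dual f⟨ a ⟩ b) ℤ.* M)  ≡⟨ sym (ℤP.*-assoc (sign c) _ M) ⟩
      sign c ℤ.* sign (dual f⟨ a ⟩ b) ℤ.* M    ≡⟨ cong (ℤ._* M) (sym (sign-xor c _)) ⟩
      sign (c xor dual f⟨ a ⟩ b) ℤ.* M         ∎

    block : (Fin ℓ → Bool) → 𝔽 → Vec Bool q
    block a b = codeword a b (dual f⟨ a ⟩ b)

    blockWord : (Fin ℓ → Bool) → 𝔽 → 𝔽 → Bool
    blockWord a b = word a b (dual f⟨ a ⟩ b)

    corr-block : ∀ a → Nonzero a → ∀ b → corr a b (dual f⟨ a ⟩ b) ≡ M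
    corr-block a a≢0 b = trans (corr-nonzero a a≢0 b (dual f⟨ a ⟩ b))
      (trans (cong (λ c → sign c ℤ.* M) (BP.xor-same (dual f⟨ a ⟩ b))) (ℤP.*-identityˡ M))

    wt-block : ∀ a → Nonzero a → ∀ b → pos (wt (block a b)) ℤ.* pos 2 ℤ.+ M ≡ Q
    wt-block a a≢0 b = trans (cong (λ s → pos (wt (block a b)) ℤ.* pos 2 ℤ.+ s) (sym (corr-block a a≢0 b))) (wt-codeword a b _)

    block≢zeroVec : ∀ a → Nonzero a → ∀ b → block a b ≢ zeroVec
    block≢zeroVec a a≢0 b block≡0 = ℤP.<⇒≢ M<Q (begin
      M                                          ≡⟨ sym (ℤP.+-identityˡ M) ⟩
      pos 0 ℤ.* pos 2 ℤ.+ M                      ≡⟨ cong (λ w → pos w ℤ.* pos 2 ℤ.+ M) (sym (trans (cong wt block≡0) (∣⊥∣≡0 q))) ⟩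
      pos (wt (block a b)) ℤ.* pos 2 ℤ.+ M       ≡⟨ wt-block a a≢0 b ⟩
      Q                                          ∎)
      where open import Data.Fin.Subset.Properties using (∣⊥∣≡0)

    corr≤0 : ∀ a → ¬ Nonzero a → ∀ b c → codeword a b c ≢ zeroVec → corr a b c ℤ.≤ pos 0
    corr≤0 a a≡0 b c c≢0 rewrite W-zero a a≡0 b with b ≟ 0#
    ... | no b≢0 = ℤP.≤-reflexive (trans (cong (sign c ℤ.*_) (∑χ-nonzero b b≢0)) (ℤP.*-zeroʳ (sign c)))
    ... | yes refl with c
    ...   | true  = subst (ℤ._≤ pos 0) (sym (trans (cong (sign true ℤ.*_) ∑χ-0) (ℤP.-1*i≡-i Q))) ℤP.neg-≤-pos
    ...   | false = ⊥-elim (c≢0 (sym (trans zeroVec≡tabulate (VP.tabulate-cong λ i → sym (trans (BP.xor-identityʳ _)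
                       (cong₂ _xor_ (lincomb-zero (u i) (¬nonzero⇒≡false a a≡0)) (trans (cong tr (zeroˡ (u i))) tr-0)))))))

    corr≤M : ∀ a b c → codeword a b c ≢ zeroVec → corr a b c ℤ.≤ M
    corr≤M a b c c≢0 with nonzero? a
    ... | yes a≢0 = subst (ℤ._≤ M) (sym (corr-nonzero a a≢0 b c)) (sign*≤ (c xor dual f⟨ a ⟩ b) (2 ℕ.^ m))
    ... | no  a≡0 = ℤP.≤-trans (corr≤0 a a≡0 b c c≢0) (ℤP.<⇒≤ 0<M)

    block-minimal : ∀ a → Nonzero a → ∀ b → IsMinWeightCodeword (InCode K F) (block a b)
    block-minimal a a≢0 b = codeword-inCode a b _ , block≢zeroVec a a≢0 b , minimal
      where
      minimal : ∀ v → InCode K F v → v ≢ zeroVec → wt (block a b) ℕ.≤ wt v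
      minimal v v∈C v≢0 with inCode⇒codeword v∈C
      ... | a′ , b′ , c′ , refl = *2-cancel-≤ _ _ (+-cancel-≤ _ _ (corr a′ b′ c′) M
        (trans (wt-codeword a′ b′ c′) (sym (wt-block a a≢0 b))) (corr≤M a′ b′ c′ v≢0))

    -- a minimal codeword weighs at most a block, which forces its correlation up to M
    minimal⇒M≤corr : ∀ a b c → IsMinWeightCodeword (InCode K F) (codeword a b c) → ∀ a₁ → Nonzero a₁ → M ℤ.≤ corr a b c
    minimal⇒M≤corr a b c (_ , _ , minimal) a₁ a₁≢0 =
      +-cancel-≤ (corr a b c) M (pos (wt (codeword a b c)) ℤ.* pos 2) (pos (wt (block a₁ 0#)) ℤ.* pos 2)
        (trans (ℤP.+-comm (corr a b c) (pos (wt (codeword a b c)) ℤ.* pos 2)) (trans (wt-codeword a b c) (sym (trans (ℤP.+-comm M (pos (wt (block a₁ 0#)) ℤ.* pos 2)) (wt-block a₁ a₁≢0 0#)))))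
        (*2-mono-≤ _ _ (minimal (block a₁ 0#) (codeword-inCode a₁ 0# _) (block≢zeroVec a₁ a₁≢0 0#)))

    minimal⇒block : Fin ℓ → ∀ v → IsMinWeightCodeword (InCode K F) v → ∃[ a ] (Nonzero a × ∃[ b ] (v ≡ block a b))
    minimal⇒block j v v-min@(v∈C , v≢0 , _) with inCode⇒codeword v∈C
    ... | a , b , c , refl with nonzero? a
    ...   | no a≡0 = ⊥-elim (ℤP.<⇒≱ 0<M (ℤP.≤-trans (minimal⇒M≤corr a b c v-min (λ _ → true) (j , refl)) (corr≤0 a a≡0 b c v≢0)))
    ...   | yes a≢0 with c BP.≟ dual f⟨ a ⟩ b
    ...     | yes refl = a , a≢0 , b , refl
    ...     | no  c≢d  = ⊥-elim (ℤP.<⇒≱ -M<M (subst (M ℤ.≤_) corr≡-M (minimal⇒M≤corr a b c v-min a a≢0)))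
      where
      corr≡-M : corr a b c ≡ ℤ.- M
      corr≡-M = trans (corr-nonzero a a≢0 b c) (trans (cong (λ x → sign x ℤ.* M) (c≢d⇒xor≡true c _ c≢d)) (ℤP.-1*i≡-i M))
        where
        c≢d⇒xor≡true : ∀ c d → c ≢ d → c xor d ≡ true
        c≢d⇒xor≡true true  true  c≢d = ⊥-elim (c≢d refl)
        c≢d⇒xor≡true true  false _   = refl
        c≢d⇒xor≡true false true  _   = refl
        c≢d⇒xor≡true false false c≢d = ⊥-elim (c≢d refl)

    isBlock⇒block : Fin ℓ → ∀ {B} → IsBlock K F B → ∃[ a ] (Nonzero a × ∃[ b ] (B ≡ block a b))
    isBlock⇒block j (v , v-min , refl) = minimal⇒block j v v-min

    block-isBlock : ∀ a → Nonzero a → ∀ b → IsBlock K F (block a b)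
    block-isBlock a a≢0 b = block a b , block-minimal a a≢0 b , refl

module Intersections where

  open import Defs hiding (q; u; tr)
  open Characters using (sign-xor; sign*sign≡1)
  open Counting using (𝟙)
  open Blocks using (module MinimumWeight; ∣∩∣*4+∑sign≡N; isNegative)
  open import Data.Nat as ℕ using (ℕ; suc; z≤n; s≤s)
  import Data.Nat.Properties as ℕP
  open import Data.Fin using (Fin)
  open import Data.Bool using (Bool; true; false; _xor_; _∧_)
  import Data.Bool.Properties as BP
  import Data.Vec as V
  import Data.Vec.Properties as VP
  open import Data.Fin.Subset using (∣_∣; _∩_)
  open import Data.Product using (_×_; _,_)
  open import Data.Empty using (⊥-elim)
  open import Function using (_∘_)
  open import Relation.Binary.PropositionalEquality
  open import Relation.Nullary using (yes; no; ¬_)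
  import Data.Integer as ℤ
  open ℤ using (ℤ) renaming (+_ to pos)
  import Data.Integer.Properties as ℤP
  open import Data.Integer.Tactic.RingSolver using (solve-∀)

  module BlockIntersections (t : ℕ) (K : GF2^ (2 ℕ.* suc (suc t))) {ℓ : ℕ} (F : Fin ℓ → Carrier K → Bool)
                       (bent : IsBentVectorial (suc (suc t)) K F) where
    open MinimumWeight t K F bent public
    open ≡-Reasoning

    _⊻_ : (Fin ℓ → Bool) → (Fin ℓ → Bool) → Fin ℓ → Bool
    (a ⊻ a′) j = a j xor a′ j

    ¬nonzero[a⊻a′]⇒a≡a′ : ∀ a a′ → ¬ Nonzero (a ⊻ a′) → ∀ j → a j ≡ a′ j
    ¬nonzero[a⊻a′]⇒a≡a′ a a′ a≡a′ j = xor≡false (a j) (a′ j) (¬nonzero⇒≡false (a ⊻ a′) a≡a′ j)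
      where
      xor≡false : ∀ x y → x xor y ≡ false → x ≡ y
      xor≡false true  true  _  = refl
      xor≡false false false _  = refl
      xor≡false true  false ()
      xor≡false false true  ()

    nonzero[a⊻a] : ∀ a → ¬ Nonzero (a ⊻ a)
    nonzero[a⊻a] a (j , e) with trans (sym (BP.xor-same (a j))) e
    ... | ()

    dual-cong : ∀ {a a′} → (∀ j → a j ≡ a′ j) → ∀ b → dual f⟨ a ⟩ b ≡ dual f⟨ a′ ⟩ b
    dual-cong a≡a′ b = cong isNegative (W-cong (λ x → lincomb-cong x a≡a′) b)

    blockWord-cong : ∀ {a a′} → (∀ j → a j ≡ a′ j) → ∀ b x → blockWord a b x ≡ blockWord a′ b x
    blockWord-cong a≡a′ b x = cong₂ (λ p c → (p xor tr (b * x)) xor c) (lincomb-cong x a≡a′) (dual-cong a≡a′ b)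

    block-cong : ∀ {a a′} → (∀ j → a j ≡ a′ j) → ∀ b → block a b ≡ block a′ b
    block-cong a≡a′ b = VP.tabulate-cong (blockWord-cong a≡a′ b ∘ u)

    blockWord-lookup : ∀ a b x → V.lookup (block a b) (index x) ≡ blockWord a b x
    blockWord-lookup a b x = trans (VP.lookup∘tabulate (blockWord a b ∘ u) (index x)) (cong (blockWord a b) (u∘index x))

    intersectionSign : (Fin ℓ → Bool) → 𝔽 → (Fin ℓ → Bool) → 𝔽 → Bool
    intersectionSign a b a′ b′ = (dual f⟨ a ⟩ b xor dual f⟨ a′ ⟩ b′) xor dual f⟨ a ⊻ a′ ⟩ (b + b′)

    corrPair : (Fin ℓ → Bool) → 𝔽 → (Fin ℓ → Bool) → 𝔽 → ℤ
    corrPair a b a′ b′ = corr (a ⊻ a′) (b + b′) (dual f⟨ a ⟩ b xor dual f⟨ a′ ⟩ b′)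

    ∑sign-blockWord-xor : ∀ a b a′ b′ →
      ∑ (λ x → sign (blockWord a b x xor blockWord a′ b′ x)) ≡ corrPair a b a′ b′
    ∑sign-blockWord-xor a b a′ b′ =
      trans (∑-cong (λ x → cong sign (word-xor a b (dual f⟨ a ⟩ b) a′ b′ (dual f⟨ a′ ⟩ b′) x))) (∑sign-word (a ⊻ a′) (b + b′) (dual f⟨ a ⟩ b xor dual f⟨ a′ ⟩ b′))

    corr-intersection : ∀ a b a′ b′ → Nonzero (a ⊻ a′) →
      corrPair a b a′ b′ ≡ sign (intersectionSign a b a′ b′) ℤ.* M
    corr-intersection a b a′ b′ = λ a⊻a′≢0 → corr-nonzero (a ⊻ a′) a⊻a′≢0 (b + b′) (dual f⟨ a ⟩ b xor dual f⟨ a′ ⟩ b′)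

    corr-sameCombination : ∀ a b a′ b′ → ¬ Nonzero (a ⊻ a′) → b ≢ b′ →
      corrPair a b a′ b′ ≡ pos 0
    corr-sameCombination a b a′ b′ a≡a′ b≢b′ =
      trans (cong (sign (dual f⟨ a ⟩ b xor dual f⟨ a′ ⟩ b′) ℤ.*_) (trans (W-zero (a ⊻ a′) a≡a′ (b + b′)) (∑χ-≢ b b′ b≢b′))) (ℤP.*-zeroʳ (sign (dual f⟨ a ⟩ b xor dual f⟨ a′ ⟩ b′)))

    ∣∩∣-block : ∀ a → Nonzero a → ∀ b a′ → Nonzero a′ → ∀ b′ →
      pos ∣ block a b ∩ block a′ b′ ∣ ℤ.* pos 4 ℤ.+ M ℤ.+ M ℤ.- corrPair a b a′ b′ ≡ Q
    ∣∩∣-block a a≢0 b a′ a′≢0 b′ = begin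
      X ℤ.+ M ℤ.+ M ℤ.- corrPair a b a′ b′                 ≡⟨ cong₂ (λ s s′ → X ℤ.+ s ℤ.+ s′ ℤ.- corrPair a b a′ b′)
                                                                       (sym (trans (∑sign-word a b _) (corr-block a a≢0 b)))
                                                                       (sym (trans (∑sign-word a′ b′ _) (corr-block a′ a′≢0 b′))) ⟩
      X ℤ.+ ∑ (sign ∘ blockWord a b) ℤ.+ ∑ (sign ∘ blockWord a′ b′)
        ℤ.- corrPair a b a′ b′                              ≡⟨ cong (λ c → X ℤ.+ ∑ (sign ∘ blockWord a b) ℤ.+ ∑ (sign ∘ blockWord a′ b′) ℤ.- c)
                                                                       (sym (∑sign-blockWord-xor a b a′ b′)) ⟩
      X ℤ.+ ∑ (sign ∘ blockWord a b) ℤ.+ ∑ (sign ∘ blockWord a′ b′)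
        ℤ.- ∑ (λ x → sign (blockWord a b x xor blockWord a′ b′ x)) ≡⟨ ∣∩∣*4+∑sign≡N (blockWord a b ∘ u) (blockWord a′ b′ ∘ u) ⟩
      Q                                                           ∎
      where
      X = pos ∣ block a b ∩ block a′ b′ ∣ ℤ.* pos 4

    A P : ℕ
    A = 2 ℕ.^ t
    P = 2 ℕ.^ (2 ℕ.* m ℕ.∸ 2)

    kA≤P : ∀ k → k ℕ.≤ 3 → k ℕ.* A ℕ.≤ P
    kA≤P k k≤3 = ℕP.≤-trans (ℕP.*-monoˡ-≤ A (ℕP.≤-trans k≤3 (ℕP.n≤1+n 3))) (subst (4 ℕ.* A ℕ.≤_) (sym P≡A*2^m)
                    (subst (ℕ._≤ A ℕ.* 2 ℕ.^ m) (ℕP.*-comm A 4) (ℕP.*-monoʳ-≤ A (ℕP.^-monoʳ-≤ 2 {2} {m} (s≤s (s≤s z≤n))))))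
      where
      P≡A*2^m : P ≡ A ℕ.* 2 ℕ.^ m
      P≡A*2^m = trans (ℕP.^-distribˡ-+-* 2 t (m ℕ.+ 0)) (cong (λ z → A ℕ.* 2 ℕ.^ z) (ℕP.+-identityʳ m))

    -- q = 4P and 2^m = 4A
    X*4+kM≡Q⇒X≡P∸kA : ∀ k → k ℕ.≤ 3 → ∀ X → pos X ℤ.* pos 4 ℤ.+ pos k ℤ.* M ≡ Q → X ≡ P ℕ.∸ k ℕ.* A
    X*4+kM≡Q⇒X≡P∸kA k k≤3 X eq = ℤP.+-injective (ℤP.*-cancelʳ-≡ (pos X) (pos (P ℕ.∸ k ℕ.* A)) (pos 4) (begin
      pos X ℤ.* pos 4                                     ≡⟨ x≡x+y-y (pos X ℤ.* pos 4) (pos k ℤ.* M) ⟩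
      pos X ℤ.* pos 4 ℤ.+ pos k ℤ.* M ℤ.- pos k ℤ.* M     ≡⟨ cong₂ (λ a b → a ℤ.- pos k ℤ.* b) eq M≡4A ⟩
      Q ℤ.- pos k ℤ.* (pos 4 ℤ.* pos A)                   ≡⟨ cong (λ a → a ℤ.- pos k ℤ.* (pos 4 ℤ.* pos A)) Q≡4P ⟩
      pos 4 ℤ.* pos P ℤ.- pos k ℤ.* (pos 4 ℤ.* pos A)     ≡⟨ factor4 (pos P) (pos k) (pos A) ⟩
      (pos P ℤ.- pos k ℤ.* pos A) ℤ.* pos 4               ≡⟨ cong (λ a → (pos P ℤ.- a) ℤ.* pos 4) (sym (ℤP.pos-* k A)) ⟩
      (pos P ℤ.- pos (k ℕ.* A)) ℤ.* pos 4                 ≡⟨ cong (ℤ._* pos 4) (sym (pos[m∸n] P (k ℕ.* A) (kA≤P k k≤3))) ⟩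
      pos (P ℕ.∸ k ℕ.* A) ℤ.* pos 4                       ∎))
      where
      Q≡4P : Q ≡ pos 4 ℤ.* pos P
      Q≡4P = trans (cong pos (sym (ℕP.*-assoc 2 2 P))) (ℤP.pos-* 4 P)
      M≡4A : M ≡ pos 4 ℤ.* pos A
      M≡4A = trans (cong pos (sym (ℕP.*-assoc 2 2 A))) (ℤP.pos-* 4 A)
      pos[m∸n] : ∀ x y → y ℕ.≤ x → pos (x ℕ.∸ y) ≡ pos x ℤ.- pos y
      pos[m∸n] x y y≤x = trans (sym (ℤP.⊖-≥ y≤x)) (sym (ℤP.m-n≡m⊖n x y))
      x≡x+y-y : ∀ x y → x ≡ x ℤ.+ y ℤ.- y
      x≡x+y-y = solve-∀
      factor4 : ∀ p k a → pos 4 ℤ.* p ℤ.- k ℤ.* (pos 4 ℤ.* a) ≡ (p ℤ.- k ℤ.* a) ℤ.* pos 4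
      factor4 = solve-∀

    s₁ s₂ s₃ : ℕ
    s₁ = P ℕ.∸ A
    s₂ = P ℕ.∸ 2 ℕ.* A
    s₃ = P ℕ.∸ 3 ℕ.* A

    P∸kA-injective : ∀ k k′ → k′ ℕ.≤ 3 → k ℕ.< k′ → P ℕ.∸ k ℕ.* A ≢ P ℕ.∸ k′ ℕ.* A
    P∸kA-injective k k′ k′≤3 k<k′ e =
      ℕP.<⇒≢ (ℕP.*-monoˡ-< A {{ℕP.m^n≢0 2 t}} k<k′) (ℕP.∸-cancelˡ-≡ (kA≤P k (ℕP.≤-trans (ℕP.<⇒≤ k<k′) k′≤3)) (kA≤P k′ k′≤3) e)

    s₁≡P∸1*A : P ℕ.∸ 1 ℕ.* A ≡ s₁
    s₁≡P∸1*A = cong (P ℕ.∸_) (ℕP.*-identityˡ A)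

    s₁≢s₂ : s₁ ≢ s₂
    s₁≢s₂ e = P∸kA-injective 1 2 (s≤s (s≤s z≤n)) (s≤s (s≤s z≤n)) (trans s₁≡P∸1*A e)

    s₁≢s₃ : s₁ ≢ s₃
    s₁≢s₃ e = P∸kA-injective 1 3 ℕP.≤-refl (s≤s (s≤s z≤n)) (trans s₁≡P∸1*A e)

    s₂≢s₃ : s₂ ≢ s₃
    s₂≢s₃ = P∸kA-injective 2 3 ℕP.≤-refl (s≤s (s≤s (s≤s z≤n)))

    ∣∩∣≡s₁ : ∀ a → Nonzero a → ∀ b a′ → Nonzero a′ → ∀ b′ → Nonzero (a ⊻ a′) →
      intersectionSign a b a′ b′ ≡ false → ∣ block a b ∩ block a′ b′ ∣ ≡ s₁
    ∣∩∣≡s₁ a a≢0 b a′ a′≢0 b′ a⊻a′≢0 σ≡false = trans (X*4+kM≡Q⇒X≡P∸kA 1 (s≤s z≤n) _ (begin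
      X ℤ.+ pos 1 ℤ.* M                  ≡⟨ x+1*M≡x+M+M-M X M ⟩
      X ℤ.+ M ℤ.+ M ℤ.- sign false ℤ.* M ≡⟨ cong (λ σ → X ℤ.+ M ℤ.+ M ℤ.- sign σ ℤ.* M) (sym σ≡false) ⟩
      X ℤ.+ M ℤ.+ M ℤ.- sign (intersectionSign a b a′ b′) ℤ.* M ≡⟨ cong (λ c → X ℤ.+ M ℤ.+ M ℤ.- c) (sym (corr-intersection a b a′ b′ a⊻a′≢0)) ⟩
      X ℤ.+ M ℤ.+ M ℤ.- corrPair a b a′ b′ ≡⟨ ∣∩∣-block a a≢0 b a′ a′≢0 b′ ⟩
      Q                                  ∎)) s₁≡P∸1*A
      where
      X = pos ∣ block a b ∩ block a′ b′ ∣ ℤ.* pos 4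
      x+1*M≡x+M+M-M : ∀ x M → x ℤ.+ pos 1 ℤ.* M ≡ x ℤ.+ M ℤ.+ M ℤ.- pos 1 ℤ.* M
      x+1*M≡x+M+M-M = solve-∀

    ∣∩∣≡s₃ : ∀ a → Nonzero a → ∀ b a′ → Nonzero a′ → ∀ b′ → Nonzero (a ⊻ a′) →
      intersectionSign a b a′ b′ ≡ true → ∣ block a b ∩ block a′ b′ ∣ ≡ s₃
    ∣∩∣≡s₃ a a≢0 b a′ a′≢0 b′ a⊻a′≢0 σ≡true = X*4+kM≡Q⇒X≡P∸kA 3 ℕP.≤-refl _ (begin
      X ℤ.+ pos 3 ℤ.* M                  ≡⟨ x+3*M≡x+M+M+M X M ⟩
      X ℤ.+ M ℤ.+ M ℤ.- sign true ℤ.* M  ≡⟨ cong (λ σ → X ℤ.+ M ℤ.+ M ℤ.- sign σ ℤ.* M) (sym σ≡true) ⟩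
      X ℤ.+ M ℤ.+ M ℤ.- sign (intersectionSign a b a′ b′) ℤ.* M ≡⟨ cong (λ c → X ℤ.+ M ℤ.+ M ℤ.- c) (sym (corr-intersection a b a′ b′ a⊻a′≢0)) ⟩
      X ℤ.+ M ℤ.+ M ℤ.- corrPair a b a′ b′ ≡⟨ ∣∩∣-block a a≢0 b a′ a′≢0 b′ ⟩
      Q                                  ∎)
      where
      X = pos ∣ block a b ∩ block a′ b′ ∣ ℤ.* pos 4
      x+3*M≡x+M+M+M : ∀ x M → x ℤ.+ pos 3 ℤ.* M ≡ x ℤ.+ M ℤ.+ M ℤ.- ℤ.- pos 1 ℤ.* M
      x+3*M≡x+M+M+M = solve-∀

    ∣∩∣≡s₂ : ∀ a → Nonzero a → ∀ b a′ → Nonzero a′ → ∀ b′ → ¬ Nonzero (a ⊻ a′) → b ≢ b′ →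
      ∣ block a b ∩ block a′ b′ ∣ ≡ s₂
    ∣∩∣≡s₂ a a≢0 b a′ a′≢0 b′ a≡a′ b≢b′ = X*4+kM≡Q⇒X≡P∸kA 2 (s≤s (s≤s z≤n)) _ (begin
      X ℤ.+ pos 2 ℤ.* M                  ≡⟨ x+2*M≡x+M+M-0 X M ⟩
      X ℤ.+ M ℤ.+ M ℤ.- pos 0            ≡⟨ cong (λ c → X ℤ.+ M ℤ.+ M ℤ.- c) (sym (corr-sameCombination a b a′ b′ a≡a′ b≢b′)) ⟩
      X ℤ.+ M ℤ.+ M ℤ.- corrPair a b a′ b′ ≡⟨ ∣∩∣-block a a≢0 b a′ a′≢0 b′ ⟩
      Q                                  ∎)
      where
      X = pos ∣ block a b ∩ block a′ b′ ∣ ℤ.* pos 4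
      x+2*M≡x+M+M-0 : ∀ x M → x ℤ.+ pos 2 ℤ.* M ≡ x ℤ.+ M ℤ.+ M ℤ.- pos 0
      x+2*M≡x+M+M-0 = solve-∀

    ∑sign-blockWord-xor-≡ : ∀ a b a′ b′ → block a b ≡ block a′ b′ → ∑ (λ x → sign (blockWord a b x xor blockWord a′ b′ x)) ≡ Q
    ∑sign-blockWord-xor-≡ a b a′ b′ B≡B′ = begin
      ∑ (λ x → sign (blockWord a b x xor blockWord a′ b′ x))     ≡⟨ ∑-cong (λ x → cong (λ z → sign (z xor blockWord a′ b′ x)) (blockWord-≡ x)) ⟩
      ∑ (λ x → sign (blockWord a′ b′ x xor blockWord a′ b′ x))   ≡⟨ ∑-cong (λ x → cong sign (BP.xor-same (blockWord a′ b′ x))) ⟩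
      ∑ (λ _ → pos 1)                                             ≡⟨ ∑-1 ⟩
      Q                                                           ∎
      where
      blockWord-≡ : ∀ x → blockWord a b x ≡ blockWord a′ b′ x
      blockWord-≡ x = trans (sym (blockWord-lookup a b x)) (trans (cong (λ B → V.lookup B (index x)) B≡B′) (blockWord-lookup a′ b′ x))

    -- equal blocks have ∑ sign (B xor B′) = q, while distinct labels give ±2^m or 0
    block-injective : ∀ a → Nonzero a → ∀ b a′ → Nonzero a′ → ∀ b′ → block a b ≡ block a′ b′ → (∀ j → a j ≡ a′ j) × b ≡ b′
    block-injective a a≢0 b a′ a′≢0 b′ B≡B′ with nonzero? (a ⊻ a′)
    ... | yes a⊻a′≢0 = ⊥-elim (Q≢±M (intersectionSign a b a′ b′) (begin
      Q                                                           ≡⟨ sym (∑sign-blockWord-xor-≡ a b a′ b′ B≡B′) ⟩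
      ∑ (λ x → sign (blockWord a b x xor blockWord a′ b′ x))      ≡⟨ ∑sign-blockWord-xor a b a′ b′ ⟩
      corrPair a b a′ b′                                    ≡⟨ corr-intersection a b a′ b′ a⊻a′≢0 ⟩
      sign (intersectionSign a b a′ b′) ℤ.* M                     ∎))
      where
      Q≢±M : ∀ σ → Q ≢ sign σ ℤ.* M
      Q≢±M false e = ℤP.<⇒≢ M<Q (sym (trans e (ℤP.*-identityˡ M)))
      Q≢±M true  e = ℤP.<⇒≢ (ℤP.<-trans -M<M M<Q) (sym (trans e (ℤP.-1*i≡-i M)))
    ... | no a≡a′ with b ≟ b′
    ...   | yes b≡b′ = ¬nonzero[a⊻a′]⇒a≡a′ a a′ a≡a′ , b≡b′
    ...   | no  b≢b′ = ⊥-elim (ℤP.<⇒≢ (ℤP.<-trans 0<M M<Q) (sym (begin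
      Q                                                           ≡⟨ sym (∑sign-blockWord-xor-≡ a b a′ b′ B≡B′) ⟩
      ∑ (λ x → sign (blockWord a b x xor blockWord a′ b′ x))      ≡⟨ ∑sign-blockWord-xor a b a′ b′ ⟩
      corrPair a b a′ b′                                    ≡⟨ corr-sameCombination a b a′ b′ a≡a′ b≢b′ ⟩
      pos 0                                                       ∎)))

    sign*[sign*x]≡x : ∀ d x → sign d ℤ.* (sign d ℤ.* x) ≡ x
    sign*[sign*x]≡x d x = trans (sym (ℤP.*-assoc (sign d) (sign d) x)) (trans (cong (ℤ._* x) (sign*sign≡1 d)) (ℤP.*-identityˡ x))

    -- Convolving W f_{a⊕a′} with W f_{a′} gives q W f_a; all three Walsh values are ±2^m.
    ∑sign-intersectionSign : ∀ a → Nonzero a → ∀ b a′ → Nonzero a′ → Nonzero (a ⊻ a′) →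
      ∑ (λ b′ → sign (intersectionSign a b a′ b′)) ≡ M
    ∑sign-intersectionSign a a≢0 b a′ a′≢0 a⊻a′≢0 = begin
      ∑ (λ b′ → sign (intersectionSign a b a′ b′))            ≡⟨ ∑-cong (λ b′ → trans (sign-xor (d xor d′ b′) (d″ (b + b′))) (cong (ℤ._* sign (d″ (b + b′))) (sign-xor d (d′ b′)))) ⟩
      ∑ (λ b′ → sign d ℤ.* sign (d′ b′) ℤ.* sign (d″ (b + b′))) ≡⟨ ∑-cong (λ b′ → ℤP.*-assoc (sign d) (sign (d′ b′)) (sign (d″ (b + b′)))) ⟩
      ∑ (λ b′ → sign d ℤ.* (sign (d′ b′) ℤ.* sign (d″ (b + b′)))) ≡⟨ ∑-*ˡ (sign d) (λ b′ → sign (d′ b′) ℤ.* sign (d″ (b + b′))) ⟩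
      sign d ℤ.* T                                            ≡⟨ cong (sign d ℤ.*_) T≡sign[d]*M ⟩
      sign d ℤ.* (sign d ℤ.* M)                               ≡⟨ sign*[sign*x]≡x d M ⟩
      M                                                       ∎
      where
      d = dual f⟨ a ⟩ b
      d′ = dual f⟨ a′ ⟩
      d″ = dual f⟨ a ⊻ a′ ⟩
      T = ∑ (λ w → sign (d′ w) ℤ.* sign (d″ (b + w)))
      f⟨a⊻a′⟩+f⟨a′⟩≡f⟨a⟩ : ∀ x → f⟨ a ⊻ a′ ⟩ x xor f⟨ a′ ⟩ x ≡ f⟨ a ⟩ x
      f⟨a⊻a′⟩+f⟨a′⟩≡f⟨a⟩ x = begin
        f⟨ a ⊻ a′ ⟩ x xor f⟨ a′ ⟩ x                   ≡⟨ cong (_xor f⟨ a′ ⟩ x) (lincomb-xor a a′ x) ⟩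
        (f⟨ a ⟩ x xor f⟨ a′ ⟩ x) xor f⟨ a′ ⟩ x        ≡⟨ BP.xor-assoc (f⟨ a ⟩ x) (f⟨ a′ ⟩ x) (f⟨ a′ ⟩ x) ⟩
        f⟨ a ⟩ x xor (f⟨ a′ ⟩ x xor f⟨ a′ ⟩ x)        ≡⟨ cong (f⟨ a ⟩ x xor_) (BP.xor-same (f⟨ a′ ⟩ x)) ⟩
        f⟨ a ⟩ x xor false                            ≡⟨ BP.xor-identityʳ (f⟨ a ⟩ x) ⟩
        f⟨ a ⟩ x                                      ∎
      convolution : ∑ (λ w → W f⟨ a ⊻ a′ ⟩ (w + b) ℤ.* W f⟨ a′ ⟩ w) ≡ T ℤ.* (M ℤ.* M)
      convolution = trans (∑-cong (λ w → trans (cong₂ ℤ._*_ (W-bent (a ⊻ a′) a⊻a′≢0 (w + b)) (W-bent a′ a′≢0 w))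
                      (trans (regroup (sign (d″ (w + b))) (sign (d′ w)) M) (cong (λ z → sign (d′ w) ℤ.* sign (d″ z) ℤ.* (M ℤ.* M)) (+-comm w b)))))
                    (∑-*ʳ (M ℤ.* M) (λ w → sign (d′ w) ℤ.* sign (d″ (b + w))))
        where
        regroup : ∀ x y M → x ℤ.* M ℤ.* (y ℤ.* M) ≡ y ℤ.* x ℤ.* (M ℤ.* M)
        regroup = solve-∀
      T≡sign[d]*M : T ≡ sign d ℤ.* M
      T≡sign[d]*M = ℤP.*-cancelʳ-≡ T (sign d ℤ.* M) (M ℤ.* M) {{subst ℤ.NonZero Q≡M*M (ℕP.m^n≢0 2 (2 ℕ.* m))}} (begin
        T ℤ.* (M ℤ.* M)                                        ≡⟨ sym convolution ⟩
        ∑ (λ w → W f⟨ a ⊻ a′ ⟩ (w + b) ℤ.* W f⟨ a′ ⟩ w)        ≡⟨ W-convolution f⟨ a ⊻ a′ ⟩ f⟨ a′ ⟩ b ⟩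
        Q ℤ.* W (λ x → f⟨ a ⊻ a′ ⟩ x xor f⟨ a′ ⟩ x) b          ≡⟨ cong₂ ℤ._*_ Q≡M*M (trans (W-cong f⟨a⊻a′⟩+f⟨a′⟩≡f⟨a⟩ b) (W-bent a a≢0 b)) ⟩
        M ℤ.* M ℤ.* (sign d ℤ.* M)                             ≡⟨ ℤP.*-comm (M ℤ.* M) _ ⟩
        sign d ℤ.* M ℤ.* (M ℤ.* M)                             ∎)

    -- Fourier inversion applied to the dual of the bent function f_a
    ∑sign-blockWord-column : ∀ a → Nonzero a → ∀ x → ∑ (λ b → sign (blockWord a b x)) ≡ M
    ∑sign-blockWord-column a a≢0 x = begin
      ∑ (λ b → sign (blockWord a b x))                          ≡⟨ ∑-cong (λ b → trans (sign-xor (f⟨ a ⟩ x xor tr (b * x)) (dual f⟨ a ⟩ b))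
                                                                     (cong (ℤ._* sign (dual f⟨ a ⟩ b)) (sign-xor (f⟨ a ⟩ x) (tr (b * x))))) ⟩
      ∑ (λ b → sign (f⟨ a ⟩ x) ℤ.* χ (b * x) ℤ.* sign (dual f⟨ a ⟩ b)) ≡⟨ ∑-cong (λ b → regroup (sign (f⟨ a ⟩ x)) (χ (b * x)) (sign (dual f⟨ a ⟩ b))) ⟩
      ∑ (λ b → sign (f⟨ a ⟩ x) ℤ.* (sign (dual f⟨ a ⟩ b) ℤ.* χ (b * x))) ≡⟨ ∑-*ˡ (sign (f⟨ a ⟩ x)) (λ b → sign (dual f⟨ a ⟩ b) ℤ.* χ (b * x)) ⟩
      sign (f⟨ a ⟩ x) ℤ.* T                                     ≡⟨ cong (sign (f⟨ a ⟩ x) ℤ.*_) T≡M*sign ⟩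
      sign (f⟨ a ⟩ x) ℤ.* (M ℤ.* sign (f⟨ a ⟩ x))               ≡⟨ cong (sign (f⟨ a ⟩ x) ℤ.*_) (ℤP.*-comm M _) ⟩
      sign (f⟨ a ⟩ x) ℤ.* (sign (f⟨ a ⟩ x) ℤ.* M)               ≡⟨ sign*[sign*x]≡x (f⟨ a ⟩ x) M ⟩
      M                                                         ∎
      where
      regroup : ∀ p c s → p ℤ.* c ℤ.* s ≡ p ℤ.* (s ℤ.* c)
      regroup = solve-∀
      T = ∑ (λ w → sign (dual f⟨ a ⟩ w) ℤ.* χ (w * x))
      T≡M*sign : T ≡ M ℤ.* sign (f⟨ a ⟩ x)
      T≡M*sign = ℤP.*-cancelʳ-≡ T (M ℤ.* sign (f⟨ a ⟩ x)) M {{ℕP.m^n≢0 2 m}} (begin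
        T ℤ.* M                                                 ≡⟨ sym (∑-*ʳ M (λ w → sign (dual f⟨ a ⟩ w) ℤ.* χ (w * x))) ⟩
        ∑ (λ w → sign (dual f⟨ a ⟩ w) ℤ.* χ (w * x) ℤ.* M)      ≡⟨ ∑-cong (λ w → trans (swap (sign (dual f⟨ a ⟩ w)) (χ (w * x)) M)
                                                                     (cong (ℤ._* χ (w * x)) (sym (W-bent a a≢0 w)))) ⟩
        ∑ (λ w → W f⟨ a ⟩ w ℤ.* χ (w * x))                      ≡⟨ W-inversion f⟨ a ⟩ x ⟩
        Q ℤ.* sign (f⟨ a ⟩ x)                                   ≡⟨ cong (ℤ._* sign (f⟨ a ⟩ x)) Q≡M*M ⟩
        M ℤ.* M ℤ.* sign (f⟨ a ⟩ x)                             ≡⟨ swap′ M (sign (f⟨ a ⟩ x)) ⟩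
        M ℤ.* sign (f⟨ a ⟩ x) ℤ.* M                             ∎)
        where
        swap : ∀ s c M → s ℤ.* c ℤ.* M ≡ s ℤ.* M ℤ.* c
        swap = solve-∀
        swap′ : ∀ M s → M ℤ.* M ℤ.* s ≡ M ℤ.* s ℤ.* M
        swap′ = solve-∀

    ∑sign-blockWord-pair : ∀ a → Nonzero a → ∀ x y → x ≢ y → ∑ (λ b → sign (blockWord a b x) ℤ.* sign (blockWord a b y)) ≡ pos 0
    ∑sign-blockWord-pair a a≢0 x y x≢y = begin
      ∑ (λ b → sign (blockWord a b x) ℤ.* sign (blockWord a b y))   ≡⟨ ∑-cong pointwise ⟩
      ∑ (λ b → sign (f⟨ a ⟩ x) ℤ.* sign (f⟨ a ⟩ y) ℤ.* χ (b * (x + y))) ≡⟨ ∑-*ˡ (sign (f⟨ a ⟩ x) ℤ.* sign (f⟨ a ⟩ y)) (λ b → χ (b * (x + y))) ⟩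
      sign (f⟨ a ⟩ x) ℤ.* sign (f⟨ a ⟩ y) ℤ.* ∑χ (x + y)            ≡⟨ cong (sign (f⟨ a ⟩ x) ℤ.* sign (f⟨ a ⟩ y) ℤ.*_) (∑χ-≢ x y x≢y) ⟩
      sign (f⟨ a ⟩ x) ℤ.* sign (f⟨ a ⟩ y) ℤ.* pos 0                 ≡⟨ ℤP.*-zeroʳ (sign (f⟨ a ⟩ x) ℤ.* sign (f⟨ a ⟩ y)) ⟩
      pos 0                                                         ∎
      where
      pointwise : ∀ b → sign (blockWord a b x) ℤ.* sign (blockWord a b y) ≡ sign (f⟨ a ⟩ x) ℤ.* sign (f⟨ a ⟩ y) ℤ.* χ (b * (x + y))
      pointwise b = begin
        sign (blockWord a b x) ℤ.* sign (blockWord a b y)              ≡⟨ cong₂ ℤ._*_ (signs x) (signs y) ⟩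
        sign (f⟨ a ⟩ x) ℤ.* χ (b * x) ℤ.* sign d ℤ.* (sign (f⟨ a ⟩ y) ℤ.* χ (b * y) ℤ.* sign d)
                                                                       ≡⟨ regroup (sign (f⟨ a ⟩ x)) (χ (b * x)) (sign d) (sign (f⟨ a ⟩ y)) (χ (b * y)) ⟩
        sign (f⟨ a ⟩ x) ℤ.* sign (f⟨ a ⟩ y) ℤ.* (χ (b * x) ℤ.* χ (b * y)) ℤ.* (sign d ℤ.* sign d)
                                                                       ≡⟨ cong₂ (λ p s → sign (f⟨ a ⟩ x) ℤ.* sign (f⟨ a ⟩ y) ℤ.* p ℤ.* s) (χ-*-+ b x y) (sign*sign≡1 d) ⟩
        sign (f⟨ a ⟩ x) ℤ.* sign (f⟨ a ⟩ y) ℤ.* χ (b * (x + y)) ℤ.* pos 1 ≡⟨ ℤP.*-identityʳ _ ⟩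
        sign (f⟨ a ⟩ x) ℤ.* sign (f⟨ a ⟩ y) ℤ.* χ (b * (x + y))        ∎
        where
        d = dual f⟨ a ⟩ b
        signs : ∀ z → sign (blockWord a b z) ≡ sign (f⟨ a ⟩ z) ℤ.* χ (b * z) ℤ.* sign d
        signs z = trans (sign-xor (f⟨ a ⟩ z xor tr (b * z)) d) (cong (ℤ._* sign d) (sign-xor (f⟨ a ⟩ z) (tr (b * z))))
        regroup : ∀ p c s p′ c′ → p ℤ.* c ℤ.* s ℤ.* (p′ ℤ.* c′ ℤ.* s) ≡ p ℤ.* p′ ℤ.* (c ℤ.* c′) ℤ.* (s ℤ.* s)
        regroup = solve-∀

    -- 4 [p ∧ r] = 1 - (-1)^p - (-1)^r + (-1)^(p+r), summed over b
    ∑𝟙[both]*4 : ∀ a → Nonzero a → ∀ x y → x ≢ y →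
      ∑ (λ b → pos (𝟙 (blockWord a b x ∧ blockWord a b y))) ℤ.* pos 4 ℤ.+ pos 2 ℤ.* M ≡ Q
    ∑𝟙[both]*4 a a≢0 x y x≢y = begin
      ∑ (λ b → pos (𝟙 (w b x ∧ w b y))) ℤ.* pos 4 ℤ.+ pos 2 ℤ.* M
          ≡⟨ cong (λ z → z ℤ.+ pos 2 ℤ.* M) (sym (∑-*ʳ (pos 4) (λ b → pos (𝟙 (w b x ∧ w b y))))) ⟩
      ∑ (λ b → pos (𝟙 (w b x ∧ w b y)) ℤ.* pos 4) ℤ.+ pos 2 ℤ.* M
          ≡⟨ cong (λ z → z ℤ.+ pos 2 ℤ.* M) (∑-cong (λ b → pointwise (w b x) (w b y))) ⟩
      ∑ (λ b → pos 1 ℤ.+ (−sx b ℤ.+ (−sy b ℤ.+ sxy b))) ℤ.+ pos 2 ℤ.* M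
          ≡⟨ cong (λ z → z ℤ.+ pos 2 ℤ.* M) (trans (∑-+ (λ _ → pos 1) (λ b → −sx b ℤ.+ (−sy b ℤ.+ sxy b)))
               (cong₂ ℤ._+_ ∑-1 (trans (∑-+ −sx (λ b → −sy b ℤ.+ sxy b)) (cong (λ z → ∑ −sx ℤ.+ z) (∑-+ −sy sxy))))) ⟩
      Q ℤ.+ (∑ −sx ℤ.+ (∑ −sy ℤ.+ ∑ sxy)) ℤ.+ pos 2 ℤ.* M
          ≡⟨ cong₂ (λ p r → Q ℤ.+ (p ℤ.+ (r ℤ.+ ∑ sxy)) ℤ.+ pos 2 ℤ.* M) (∑−sign≡−M x) (∑−sign≡−M y) ⟩
      Q ℤ.+ (ℤ.- pos 1 ℤ.* M ℤ.+ (ℤ.- pos 1 ℤ.* M ℤ.+ ∑ sxy)) ℤ.+ pos 2 ℤ.* M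
          ≡⟨ cong (λ z → Q ℤ.+ (ℤ.- pos 1 ℤ.* M ℤ.+ (ℤ.- pos 1 ℤ.* M ℤ.+ z)) ℤ.+ pos 2 ℤ.* M) (∑sign-blockWord-pair a a≢0 x y x≢y) ⟩
      Q ℤ.+ (ℤ.- pos 1 ℤ.* M ℤ.+ (ℤ.- pos 1 ℤ.* M ℤ.+ pos 0)) ℤ.+ pos 2 ℤ.* M
          ≡⟨ cancel Q M ⟩
      Q   ∎
      where
      w : 𝔽 → 𝔽 → Bool
      w = blockWord a
      −sx −sy sxy : 𝔽 → ℤ
      −sx b = ℤ.- pos 1 ℤ.* sign (w b x)
      −sy b = ℤ.- pos 1 ℤ.* sign (w b y)
      sxy b = sign (w b x) ℤ.* sign (w b y)
      pointwise : ∀ p r → pos (𝟙 (p ∧ r)) ℤ.* pos 4 ≡ pos 1 ℤ.+ (ℤ.- pos 1 ℤ.* sign p ℤ.+ (ℤ.- pos 1 ℤ.* sign r ℤ.+ sign p ℤ.* sign r))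
      pointwise true  true  = refl
      pointwise true  false = refl
      pointwise false true  = refl
      pointwise false false = refl
      ∑−sign≡−M : ∀ z → ∑ (λ b → ℤ.- pos 1 ℤ.* sign (w b z)) ≡ ℤ.- pos 1 ℤ.* M
      ∑−sign≡−M z = trans (∑-*ˡ (ℤ.- pos 1) (λ b → sign (w b z))) (cong (ℤ.- pos 1 ℤ.*_) (∑sign-blockWord-column a a≢0 z))
      cancel : ∀ Q M → Q ℤ.+ (ℤ.- pos 1 ℤ.* M ℤ.+ (ℤ.- pos 1 ℤ.* M ℤ.+ pos 0)) ℤ.+ pos 2 ℤ.* M ≡ Q
      cancel = solve-∀

module Design where

  open import Defs hiding (q; u; tr)
  open Counting
  open Characters using (module ℤ∑)
  open Intersections using (module BlockIntersections)
  open import Data.Nat as ℕ using (ℕ; zero; suc; z≤n; s≤s)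
  import Data.Nat.Properties as ℕP
  open import Data.Nat.ListAction using (sum)
  open import Data.Fin as Fin using (Fin)
  open import Data.Bool using (Bool; true; false; not; _xor_; _∧_)
  import Data.Bool.Properties as BP
  open import Data.List as L using (List; map; allFin; length; cartesianProduct; filter)
  import Data.List.Properties as LP
  open import Data.List.Membership.Propositional using (_∈_)
  open import Data.List.Membership.Propositional.Properties
    using (∈-map⁺; ∈-map⁻; ∈-cartesianProduct⁺; ∈-cartesianProduct⁻; ∈-allFin; ∈-filter⁺; ∈-filter⁻)
  open import Data.List.Relation.Unary.Unique.Propositional using (Unique)
  import Data.List.Relation.Unary.Unique.Propositional.Properties as Unique
  open import Data.Vec as V using (Vec; tabulate; replicate)
  import Data.Vec.Properties as VP
  open import Data.Fin.Subset using (Subset; ∣_∣; _∩_; ∁)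
  import Data.Fin.Subset as Subset
  open import Data.Fin.Subset.Properties using (_∈?_)
  open import Data.Product using (Σ; ∃-syntax; _×_; _,_; proj₁; proj₂)
  open import Data.Sum using (_⊎_; inj₁; inj₂)
  open import Data.Empty using (⊥-elim)
  open import Function using (_∘_; _⇔_; mk⇔)
  open import Relation.Binary.PropositionalEquality
  open import Relation.Nullary using (yes; no; does; ¬_; ¬?; _×-dec_)
  open import Relation.Nullary.Decidable using (dec-true; dec-false)
  open import Relation.Unary using (Decidable)
  import Data.Integer as ℤ
  open ℤ using (ℤ) renaming (+_ to pos)
  import Data.Integer.Properties as ℤP
  open import Data.Integer.Tactic.RingSolver using (solve-∀)
  open import Data.Nat.Tactic.RingSolver using () renaming (solve-∀ to solve-ℕ)
  open import Algebra.Properties.AbelianGroup ℤP.+-0-abelianGroup using () renaming (∙-cancelʳ to +-cancelʳ)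

  lookup-injective : ∀ {k} {A : Set} (v w : Vec A k) → (∀ j → V.lookup v j ≡ V.lookup w j) → v ≡ w
  lookup-injective v w e = trans (sym (VP.tabulate∘lookup v)) (trans (VP.tabulate-cong e) (VP.tabulate∘lookup w))

  does-∈? : ∀ {N} i (p : Subset N) → does (i ∈? p) ≡ V.lookup p i
  does-∈? Fin.zero    (true  V.∷ p) = refl
  does-∈? Fin.zero    (false V.∷ p) = refl
  does-∈? (Fin.suc i) (x V.∷ p)     = does-∈? i p

  -- Among 2^(l+1) - 1 vectors, all but one contribute c, and 2c = D.
  sum-others : ∀ l len T c D → len ℕ.+ 1 ≡ 2 ℕ.^ suc l → T ℕ.+ c ≡ 0 ℕ.+ len ℕ.* c → c ℕ.* 2 ≡ D → T ≡ D ℕ.* (2 ℕ.^ l ℕ.∸ 1)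
  sum-others l len T c D len+1≡2^ℓ T+c≡len*c c*2≡D with 2 ℕ.^ l | ℕP.m^n≢0 2 l
  ... | suc e | _ = trans (ℕP.+-cancelʳ-≡ c T (c ℕ.* 2 ℕ.* e) (trans T+c≡len*c (trans (cong (ℕ._* c) len≡2e+1) (expand e c))))
                          (cong (ℕ._* e) c*2≡D)
    where
    len≡2e+1 : len ≡ e ℕ.+ suc (e ℕ.+ 0)
    len≡2e+1 = ℕP.suc-injective (trans (ℕP.+-comm 1 len) len+1≡2^ℓ)
    expand : ∀ e c → (e ℕ.+ suc (e ℕ.+ 0)) ℕ.* c ≡ c ℕ.* 2 ℕ.* e ℕ.+ c
    expand = solve-ℕ

  module BlockDesign (t : ℕ) (K : GF2^ (2 ℕ.* suc (suc t))) {ℓ : ℕ} (F : Fin ℓ → Carrier K → Bool)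
                (bent : IsBentVectorial (suc (suc t)) K F) (j₀ : Fin ℓ) where
    open BlockIntersections t K F bent public
    open ≡-Reasoning

    lookup-nonzero? : Decidable (Nonzero ∘ V.lookup)
    lookup-nonzero? v = nonzero? (V.lookup v)

    nonzeroVectors : List (Vec Bool ℓ)
    nonzeroVectors = filter lookup-nonzero? (allVecs ℓ)

    nonzeroVectors-unique : Unique nonzeroVectors
    nonzeroVectors-unique = Unique.filter⁺ lookup-nonzero? (allVecs-unique ℓ)

    ∈-nonzeroVectors⁻ : ∀ {v} → v ∈ nonzeroVectors → Nonzero (V.lookup v)
    ∈-nonzeroVectors⁻ v∈ = proj₂ (∈-filter⁻ lookup-nonzero? {xs = allVecs ℓ} v∈)

    ∈-nonzeroVectors⁺ : ∀ v → Nonzero (V.lookup v) → v ∈ nonzeroVectors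
    ∈-nonzeroVectors⁺ v v≢0 = ∈-filter⁺ lookup-nonzero? (∈-allVecs v) v≢0

    length-nonzeroVectors : length nonzeroVectors ℕ.+ 1 ≡ 2 ℕ.^ ℓ
    length-nonzeroVectors = begin
      length nonzeroVectors ℕ.+ 1                          ≡⟨ cong (ℕ._+ 1) (length-filter≡sum𝟙 lookup-nonzero? (allVecs ℓ)) ⟩
      sum (map (𝟙 ∘ does ∘ lookup-nonzero?) (allVecs ℓ)) ℕ.+ 1   ≡⟨ sum-map-single (𝟙 ∘ does ∘ lookup-nonzero?) 1 (replicate ℓ false) (allVecs ℓ)
                                                                (allVecs-unique ℓ) (∈-allVecs _) (λ v _ v≢0 → cong 𝟙 (dec-true (lookup-nonzero? v) (nonzero v v≢0))) ⟩
      𝟙 (does (lookup-nonzero? (replicate ℓ false))) ℕ.+ length (allVecs ℓ) ℕ.* 1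
                                                           ≡⟨ cong₂ (λ x y → 𝟙 x ℕ.+ y) (dec-false (lookup-nonzero? (replicate ℓ false)) zero-zero) (ℕP.*-identityʳ _) ⟩
      length (allVecs ℓ)                                   ≡⟨ length-allVecs ℓ ⟩
      2 ℕ.^ ℓ                                              ∎
      where
      nonzero : ∀ v → v ≢ replicate ℓ false → Nonzero (V.lookup v)
      nonzero v v≢0 with nonzero? (V.lookup v)
      ... | yes v≢0′ = v≢0′
      ... | no  v≡0  = ⊥-elim (v≢0 (lookup-injective v (replicate ℓ false) (λ j → trans (¬nonzero⇒≡false _ v≡0 j) (sym (VP.lookup-replicate j false)))))
      zero-zero : ¬ Nonzero (V.lookup (replicate ℓ false))
      zero-zero (j , e) with trans (sym (VP.lookup-replicate j false)) e
      ... | ()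

    elements : List 𝔽
    elements = map u (allFin q)

    ∈-elements : ∀ b → b ∈ elements
    ∈-elements b = subst (_∈ elements) (u∘index b) (∈-map⁺ u (∈-allFin (index b)))

    elements-unique : Unique elements
    elements-unique = Unique.map⁺ u-injective (Unique.allFin⁺ q)

    length-elements : length elements ≡ q
    length-elements = trans (LP.length-map u (allFin q)) (LP.length-tabulate {n = q} _)

    blockAt : Vec Bool ℓ × 𝔽 → Vec Bool q
    blockAt (v , b) = block (V.lookup v) b

    blocks : List (Vec Bool q)
    blocks = map blockAt (cartesianProduct nonzeroVectors elements)

    isBlock⇒label : ∀ {B} → IsBlock K F B → Σ (Vec Bool ℓ) λ v → v ∈ nonzeroVectors × ∃[ b ] (B ≡ block (V.lookup v) b)
    isBlock⇒label B-block with isBlock⇒block j₀ B-block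
    ... | a , a≢0 , b , refl = tabulate a , ∈-nonzeroVectors⁺ (tabulate a) (j , trans (VP.lookup∘tabulate a j) aj≡1) , b ,
                               block-cong (λ j → sym (VP.lookup∘tabulate a j)) b
      where
      j = proj₁ a≢0
      aj≡1 = proj₂ a≢0

    ∈blocks⇔isBlock : ∀ B → B ∈ blocks ⇔ IsBlock K F B
    ∈blocks⇔isBlock B = mk⇔ to from
      where
      to : B ∈ blocks → IsBlock K F B
      to B∈ with ∈-map⁻ blockAt B∈
      ... | (v , b) , vb∈ , refl = block-isBlock (V.lookup v) (∈-nonzeroVectors⁻ (proj₁ (∈-cartesianProduct⁻ nonzeroVectors elements vb∈))) b
      from : IsBlock K F B → B ∈ blocks
      from B-block with isBlock⇒label B-block
      ... | v , v∈ , b , refl = ∈-map⁺ blockAt (∈-cartesianProduct⁺ v∈ (∈-elements b))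

    blocks-unique : Unique blocks
    blocks-unique = map-unique blockAt _ injective (Unique.cartesianProduct⁺ nonzeroVectors-unique elements-unique)
      where
      injective : ∀ {x y} → x ∈ cartesianProduct nonzeroVectors elements → y ∈ cartesianProduct nonzeroVectors elements → blockAt x ≡ blockAt y → x ≡ y
      injective {v , b} {v′ , b′} x∈ y∈ e
        with block-injective (V.lookup v) (∈-nonzeroVectors⁻ (proj₁ (∈-cartesianProduct⁻ nonzeroVectors elements x∈))) b
                             (V.lookup v′) (∈-nonzeroVectors⁻ (proj₁ (∈-cartesianProduct⁻ nonzeroVectors elements y∈))) b′ e
      ... | a≡a′ , refl = cong (_, b) (lookup-injective v v′ a≡a′)

    countAt : ∀ {P : Vec Bool q → Set} → Decidable P → Vec Bool ℓ → ℕ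
    countAt P? v = sum (map (λ b → 𝟙 (does (P? (block (V.lookup v) b)))) elements)

    length-filter-blocks : ∀ {P} (P? : Decidable P) → length (filter P? blocks) ≡ sum (map (countAt P?) nonzeroVectors)
    length-filter-blocks P? = begin
      length (filter P? blocks)                                           ≡⟨ length-filter≡sum𝟙 P? blocks ⟩
      sum (map (𝟙 ∘ does ∘ P?) (map blockAt (cartesianProduct nonzeroVectors elements)))
                                                                          ≡⟨ cong sum (sym (LP.map-∘ (cartesianProduct nonzeroVectors elements))) ⟩
      sum (map (𝟙 ∘ does ∘ P? ∘ blockAt) (cartesianProduct nonzeroVectors elements))
                                                                          ≡⟨ sum-cartesianProduct (𝟙 ∘ does ∘ P? ∘ blockAt) nonzeroVectors elements ⟩
      sum (map (countAt P?) nonzeroVectors)                               ∎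

    countAt≡∑ : ∀ {P} (P? : Decidable P) v → pos (countAt P? v) ≡ ∑ (λ b → pos (𝟙 (does (P? (block (V.lookup v) b)))))
    countAt≡∑ P? v = trans (cong (pos ∘ sum) (sym (LP.map-∘ {g = λ b → 𝟙 (does (P? (block (V.lookup v) b)))} {f = u} (allFin q)))) (sumℕ-allFin (λ i → 𝟙 (does (P? (block (V.lookup v) (u i))))))
      where
      sumℕ-allFin : ∀ {N} (g : Fin N → ℕ) → pos (sum (map g (allFin N))) ≡ ℤ∑.sum (pos ∘ g)
      sumℕ-allFin {N} g = trans (cong (pos ∘ sum) (LP.map-tabulate {n = N} (λ i → i) g)) (go g)
        where
        go : ∀ {N} (g : Fin N → ℕ) → pos (sum (L.tabulate g)) ≡ ℤ∑.sum (pos ∘ g)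
        go {zero}  g = refl
        go {suc N} g = trans (ℤP.pos-+ (g Fin.zero) _) (cong (λ z → pos (g Fin.zero) ℤ.+ z) (go (g ∘ Fin.suc)))

    hasCount-blocks : ∀ {P} (P? : Decidable P) N → sum (map (countAt P?) nonzeroVectors) ≡ N → HasCount (λ B → IsBlock K F B × P B) N
    hasCount-blocks P? N total≡N with hasCount-filter blocks blocks-unique ∈blocks⇔isBlock P?
    ... | L , unique , length≡ , L⇔ = L , unique , trans length≡ (trans (length-filter-blocks P?) total≡N) , L⇔

    intersection-sizes : ∀ {B B′} → IsBlock K F B → IsBlock K F B′ → B ≢ B′ →
      (∣ B ∩ B′ ∣ ≡ s₁) ⊎ (∣ B ∩ B′ ∣ ≡ s₂) ⊎ (∣ B ∩ B′ ∣ ≡ s₃)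
    intersection-sizes B-block B′-block B≢B′ with isBlock⇒label B-block | isBlock⇒label B′-block
    ... | v , v∈ , b , refl | v′ , v′∈ , b′ , refl with nonzero? (V.lookup v ⊻ V.lookup v′)
    ...   | yes a⊻a′≢0 with intersectionSign (V.lookup v) b (V.lookup v′) b′ in σ
    ...     | false = inj₁ (∣∩∣≡s₁ (V.lookup v) (∈-nonzeroVectors⁻ v∈) b (V.lookup v′) (∈-nonzeroVectors⁻ v′∈) b′ a⊻a′≢0 σ)
    ...     | true  = inj₂ (inj₂ (∣∩∣≡s₃ (V.lookup v) (∈-nonzeroVectors⁻ v∈) b (V.lookup v′) (∈-nonzeroVectors⁻ v′∈) b′ a⊻a′≢0 σ))
    intersection-sizes _ _ B≢B′ | v , v∈ , b , refl | v′ , v′∈ , b′ , refl | no a≡a′ with b ≟ b′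
    ...     | yes refl = ⊥-elim (B≢B′ (block-cong (¬nonzero[a⊻a′]⇒a≡a′ (V.lookup v) (V.lookup v′) a≡a′) b))
    ...     | no  b≢b′ = inj₂ (inj₁ (∣∩∣≡s₂ (V.lookup v) (∈-nonzeroVectors⁻ v∈) b (V.lookup v′) (∈-nonzeroVectors⁻ v′∈) b′ a≡a′ b≢b′))

    ∑𝟙[not]*2 : ∀ g → ∑ (λ b → pos (𝟙 (not (g b)))) ℤ.* pos 2 ≡ Q ℤ.+ ∑ (sign ∘ g)
    ∑𝟙[not]*2 g = begin
      ∑ (λ b → pos (𝟙 (not (g b)))) ℤ.* pos 2     ≡⟨ sym (∑-*ʳ (pos 2) (λ b → pos (𝟙 (not (g b))))) ⟩
      ∑ (λ b → pos (𝟙 (not (g b))) ℤ.* pos 2)     ≡⟨ ∑-cong (λ b → pointwise (g b)) ⟩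
      ∑ (λ b → pos 1 ℤ.+ sign (g b))              ≡⟨ ∑-+ (λ _ → pos 1) (sign ∘ g) ⟩
      ∑ (λ _ → pos 1) ℤ.+ ∑ (sign ∘ g)            ≡⟨ cong (ℤ._+ ∑ (sign ∘ g)) ∑-1 ⟩
      Q ℤ.+ ∑ (sign ∘ g)                          ∎
      where
      pointwise : ∀ x → pos (𝟙 (not x)) ℤ.* pos 2 ≡ pos 1 ℤ.+ sign x
      pointwise true  = refl
      pointwise false = refl

    ∑𝟙*2 : ∀ g → ∑ (λ b → pos (𝟙 (g b))) ℤ.* pos 2 ≡ Q ℤ.- ∑ (sign ∘ g)
    ∑𝟙*2 g = begin
      ∑ (λ b → pos (𝟙 (g b))) ℤ.* pos 2           ≡⟨ sym (∑-*ʳ (pos 2) (λ b → pos (𝟙 (g b)))) ⟩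
      ∑ (λ b → pos (𝟙 (g b)) ℤ.* pos 2)           ≡⟨ ∑-cong (λ b → pointwise (g b)) ⟩
      ∑ (λ b → pos 1 ℤ.+ ℤ.- pos 1 ℤ.* sign (g b)) ≡⟨ ∑-+ (λ _ → pos 1) (λ b → ℤ.- pos 1 ℤ.* sign (g b)) ⟩
      ∑ (λ _ → pos 1) ℤ.+ ∑ (λ b → ℤ.- pos 1 ℤ.* sign (g b)) ≡⟨ cong₂ ℤ._+_ ∑-1 (trans (∑-*ˡ (ℤ.- pos 1) (sign ∘ g)) (ℤP.-1*i≡-i _)) ⟩
      Q ℤ.- ∑ (sign ∘ g)                          ∎
      where
      pointwise : ∀ x → pos (𝟙 x) ℤ.* pos 2 ≡ pos 1 ℤ.+ ℤ.- pos 1 ℤ.* sign x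
      pointwise true  = refl
      pointwise false = refl

    h*X*2≡2h*X : ∀ h X → h ℕ.* X ℕ.* 2 ≡ 2 ℕ.* h ℕ.* X
    h*X*2≡2h*X = solve-ℕ

    -- for a fixed a ≠ a₀, the numbers of b such that block a b meets B₀ in s₁, resp. s₃ points
    c₁ c₃ : ℕ
    c₁ = 2 ℕ.^ suc t ℕ.* (2 ℕ.^ m ℕ.+ 1)
    c₃ = 2 ℕ.^ suc t ℕ.* (2 ℕ.^ m ℕ.∸ 1)

    module AroundBlock (v₀ : Vec Bool ℓ) (v₀∈ : v₀ ∈ nonzeroVectors) (b₀ : 𝔽) where
      a₀ : Fin ℓ → Bool
      a₀ = V.lookup v₀

      a₀≢0 : Nonzero a₀
      a₀≢0 = ∈-nonzeroVectors⁻ v₀∈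

      B₀ : Vec Bool q
      B₀ = block a₀ b₀

      MeetsIn : ℕ → Vec Bool q → Set
      MeetsIn s B = B ≢ B₀ × ∣ B₀ ∩ B ∣ ≡ s

      meetsIn? : ∀ s → Decidable (MeetsIn s)
      meetsIn? s B = ¬? (VP.≡-dec BP._≟_ B B₀) ×-dec (∣ B₀ ∩ B ∣ ℕ.≟ s)

      total : ℕ → ℕ
      total s = sum (map (countAt (meetsIn? s)) nonzeroVectors)

      total-split : ∀ s c → (∀ v → v ∈ nonzeroVectors → v ≢ v₀ → countAt (meetsIn? s) v ≡ c) →
        total s ℕ.+ c ≡ countAt (meetsIn? s) v₀ ℕ.+ length nonzeroVectors ℕ.* c
      total-split s c other≡c = sum-map-single (countAt (meetsIn? s)) c v₀ nonzeroVectors nonzeroVectors-unique v₀∈ other≡c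

      module Other {v : Vec Bool ℓ} (v∈ : v ∈ nonzeroVectors) (v≢v₀ : v ≢ v₀) where
        a : Fin ℓ → Bool
        a = V.lookup v

        a≢0 : Nonzero a
        a≢0 = ∈-nonzeroVectors⁻ v∈

        a₀⊻a≢0 : Nonzero (a₀ ⊻ a)
        a₀⊻a≢0 with nonzero? (a₀ ⊻ a)
        ... | yes a₀⊻a≢0 = a₀⊻a≢0
        ... | no  a₀≡a   = ⊥-elim (v≢v₀ (sym (lookup-injective v₀ v (¬nonzero[a⊻a′]⇒a≡a′ a₀ a a₀≡a))))

        block≢B₀ : ∀ b → block a b ≢ B₀
        block≢B₀ b e = v≢v₀ (lookup-injective v v₀ (proj₁ (block-injective a a≢0 b a₀ a₀≢0 b₀ e)))

        σ : 𝔽 → Bool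
        σ = intersectionSign a₀ b₀ a

        does-meetsIn-s₁ : ∀ b → does (meetsIn? s₁ (block a b)) ≡ not (σ b)
        does-meetsIn-s₁ b with σ b in σ≡
        ... | false = dec-true  (meetsIn? s₁ _) (block≢B₀ b , ∣∩∣≡s₁ a₀ a₀≢0 b₀ a a≢0 b a₀⊻a≢0 σ≡)
        ... | true  = dec-false (meetsIn? s₁ _) (λ (_ , ∣∩∣≡s₁′) → s₁≢s₃ (trans (sym ∣∩∣≡s₁′) (∣∩∣≡s₃ a₀ a₀≢0 b₀ a a≢0 b a₀⊻a≢0 σ≡)))

        does-meetsIn-s₃ : ∀ b → does (meetsIn? s₃ (block a b)) ≡ σ b
        does-meetsIn-s₃ b with σ b in σ≡
        ... | true  = dec-true  (meetsIn? s₃ _) (block≢B₀ b , ∣∩∣≡s₃ a₀ a₀≢0 b₀ a a≢0 b a₀⊻a≢0 σ≡)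
        ... | false = dec-false (meetsIn? s₃ _) (λ (_ , ∣∩∣≡s₃′) → s₁≢s₃ (trans (sym (∣∩∣≡s₁ a₀ a₀≢0 b₀ a a≢0 b a₀⊻a≢0 σ≡)) ∣∩∣≡s₃′))

        does-meetsIn-s₂ : ∀ b → does (meetsIn? s₂ (block a b)) ≡ false
        does-meetsIn-s₂ b with σ b in σ≡
        ... | true  = dec-false (meetsIn? s₂ _) (λ (_ , ∣∩∣≡s₂′) → s₂≢s₃ (trans (sym ∣∩∣≡s₂′) (∣∩∣≡s₃ a₀ a₀≢0 b₀ a a≢0 b a₀⊻a≢0 σ≡)))
        ... | false = dec-false (meetsIn? s₂ _) (λ (_ , ∣∩∣≡s₂′) → s₁≢s₂ (trans (sym (∣∩∣≡s₁ a₀ a₀≢0 b₀ a a≢0 b a₀⊻a≢0 σ≡)) ∣∩∣≡s₂′))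

        countAt-s₁ : countAt (meetsIn? s₁) v ≡ c₁
        countAt-s₁ = ℕP.*-cancelʳ-≡ _ _ 2 (ℤP.+-injective (begin
          pos (countAt (meetsIn? s₁) v ℕ.* 2)                ≡⟨ ℤP.pos-* (countAt (meetsIn? s₁) v) 2 ⟩
          pos (countAt (meetsIn? s₁) v) ℤ.* pos 2            ≡⟨ cong (ℤ._* pos 2) (trans (countAt≡∑ (meetsIn? s₁) v)
                                                                  (∑-cong (λ b → cong (pos ∘ 𝟙) (does-meetsIn-s₁ b)))) ⟩
          ∑ (λ b → pos (𝟙 (not (σ b)))) ℤ.* pos 2            ≡⟨ ∑𝟙[not]*2 σ ⟩
          Q ℤ.+ ∑ (sign ∘ σ)                                 ≡⟨ cong (λ x → Q ℤ.+ x) (∑sign-intersectionSign a₀ a₀≢0 b₀ a a≢0 a₀⊻a≢0) ⟩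
          Q ℤ.+ M                                            ≡⟨ cong (ℤ._+ M) Q≡M*M ⟩
          M ℤ.* M ℤ.+ M                                      ≡⟨ M*M+M≡M*[M+1] M ⟩
          M ℤ.* (M ℤ.+ pos 1)                                ≡⟨ sym (trans (ℤP.pos-* (2 ℕ.^ m) _) (cong (λ x → M ℤ.* x) (ℤP.pos-+ (2 ℕ.^ m) 1))) ⟩
          pos (2 ℕ.^ m ℕ.* (2 ℕ.^ m ℕ.+ 1))                  ≡⟨ cong pos (sym (h*X*2≡2h*X (2 ℕ.^ suc t) _)) ⟩
          pos (c₁ ℕ.* 2)                                     ∎))
          where
          M*M+M≡M*[M+1] : ∀ M → M ℤ.* M ℤ.+ M ≡ M ℤ.* (M ℤ.+ pos 1)
          M*M+M≡M*[M+1] = solve-∀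

        countAt-s₃ : countAt (meetsIn? s₃) v ≡ c₃
        countAt-s₃ = ℕP.*-cancelʳ-≡ _ _ 2 (ℤP.+-injective (begin
          pos (countAt (meetsIn? s₃) v ℕ.* 2)                ≡⟨ ℤP.pos-* (countAt (meetsIn? s₃) v) 2 ⟩
          pos (countAt (meetsIn? s₃) v) ℤ.* pos 2            ≡⟨ cong (ℤ._* pos 2) (trans (countAt≡∑ (meetsIn? s₃) v)
                                                                  (∑-cong (λ b → cong (pos ∘ 𝟙) (does-meetsIn-s₃ b)))) ⟩
          ∑ (λ b → pos (𝟙 (σ b))) ℤ.* pos 2                  ≡⟨ ∑𝟙*2 σ ⟩
          Q ℤ.- ∑ (sign ∘ σ)                                 ≡⟨ cong (λ x → Q ℤ.- x) (∑sign-intersectionSign a₀ a₀≢0 b₀ a a≢0 a₀⊻a≢0) ⟩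
          Q ℤ.- M                                            ≡⟨ cong (ℤ._- M) Q≡M*M ⟩
          M ℤ.* M ℤ.- M                                      ≡⟨ M*M-M≡M*[M-1] M ⟩
          M ℤ.* (M ℤ.- pos 1)                                ≡⟨ cong (λ x → M ℤ.* x) (trans (ℤP.m-n≡m⊖n (2 ℕ.^ m) 1) (ℤP.⊖-≥ (ℕP.m^n>0 2 m))) ⟩
          M ℤ.* pos (2 ℕ.^ m ℕ.∸ 1)                          ≡⟨ sym (ℤP.pos-* (2 ℕ.^ m) _) ⟩
          pos (2 ℕ.^ m ℕ.* (2 ℕ.^ m ℕ.∸ 1))                  ≡⟨ cong pos (sym (h*X*2≡2h*X (2 ℕ.^ suc t) _)) ⟩
          pos (c₃ ℕ.* 2)                                     ∎))
          where
          M*M-M≡M*[M-1] : ∀ M → M ℤ.* M ℤ.- M ≡ M ℤ.* (M ℤ.- pos 1)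
          M*M-M≡M*[M-1] = solve-∀

        countAt-s₂ : countAt (meetsIn? s₂) v ≡ 0
        countAt-s₂ = trans (sum-map-cong elements (λ b _ → cong 𝟙 (does-meetsIn-s₂ b))) (trans (sum-map-const 0 elements) (ℕP.*-zeroʳ (length elements)))

      block≢B₀ : ∀ b → b ≢ b₀ → block a₀ b ≢ B₀
      block≢B₀ b b≢b₀ e = b≢b₀ (proj₂ (block-injective a₀ a₀≢0 b a₀ a₀≢0 b₀ e))

      ∣∩∣-self : ∀ b → b ≢ b₀ → ∣ B₀ ∩ block a₀ b ∣ ≡ s₂
      ∣∩∣-self b b≢b₀ = ∣∩∣≡s₂ a₀ a₀≢0 b₀ a₀ a₀≢0 b (nonzero[a⊻a] a₀) (b≢b₀ ∘ sym)

      ¬meetsIn-B₀ : ∀ s → does (meetsIn? s B₀) ≡ false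
      ¬meetsIn-B₀ s = dec-false (meetsIn? s B₀) (λ (B₀≢B₀ , _) → B₀≢B₀ refl)

      countAt-self-s₂ : countAt (meetsIn? s₂) v₀ ℕ.+ 1 ≡ q
      countAt-self-s₂ = begin
        countAt (meetsIn? s₂) v₀ ℕ.+ 1                          ≡⟨ sum-map-single _ 1 b₀ elements elements-unique (∈-elements b₀)
                                                                    (λ b _ b≢b₀ → cong 𝟙 (dec-true (meetsIn? s₂ _) (block≢B₀ b b≢b₀ , ∣∩∣-self b b≢b₀))) ⟩
        𝟙 (does (meetsIn? s₂ B₀)) ℕ.+ length elements ℕ.* 1     ≡⟨ cong₂ (λ x y → 𝟙 x ℕ.+ y) (¬meetsIn-B₀ s₂) (ℕP.*-identityʳ _) ⟩
        length elements                                         ≡⟨ length-elements ⟩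
        q                                                       ∎

      countAt-self : ∀ s → s ≢ s₂ → countAt (meetsIn? s) v₀ ≡ 0
      countAt-self s s≢s₂ = trans (sum-map-cong elements (λ b _ → cong 𝟙 (¬meetsIn-self b))) (trans (sum-map-const 0 elements) (ℕP.*-zeroʳ (length elements)))
        where
        ¬meetsIn-self : ∀ b → does (meetsIn? s (block a₀ b)) ≡ false
        ¬meetsIn-self b with b ≟ b₀
        ... | yes refl  = ¬meetsIn-B₀ s
        ... | no  b≢b₀ = dec-false (meetsIn? s _) (λ (_ , ∣∩∣≡s) → s≢s₂ (trans (sym ∣∩∣≡s) (∣∩∣-self b b≢b₀)))

    neighbourCounts : ∀ l → ℓ ≡ suc l → ∀ {B₀} → IsBlock K F B₀ →
      HasCount (λ B → IsBlock K F B × B ≢ B₀ × ∣ B₀ ∩ B ∣ ≡ s₁) (2 ℕ.^ m ℕ.* (2 ℕ.^ m ℕ.+ 1) ℕ.* (2 ℕ.^ l ℕ.∸ 1)) ×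
      HasCount (λ B → IsBlock K F B × B ≢ B₀ × ∣ B₀ ∩ B ∣ ≡ s₂) (q ℕ.∸ 1) ×
      HasCount (λ B → IsBlock K F B × B ≢ B₀ × ∣ B₀ ∩ B ∣ ≡ s₃) (2 ℕ.^ m ℕ.* (2 ℕ.^ m ℕ.∸ 1) ℕ.* (2 ℕ.^ l ℕ.∸ 1))
    neighbourCounts l ℓ≡1+l B₀-block with isBlock⇒label B₀-block
    ... | v₀ , v₀∈ , b₀ , refl = count s₁ c₁ _ s₁≢s₂ (λ v∈ v≢v₀ → Other.countAt-s₁ v∈ v≢v₀) (h*X*2≡2h*X (2 ℕ.^ suc t) (2 ℕ.^ m ℕ.+ 1)) ,
                                 hasCount-blocks (meetsIn? s₂) (q ℕ.∸ 1) total-s₂ ,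
                                 count s₃ c₃ _ (s₂≢s₃ ∘ sym) (λ v∈ v≢v₀ → Other.countAt-s₃ v∈ v≢v₀) (h*X*2≡2h*X (2 ℕ.^ suc t) (2 ℕ.^ m ℕ.∸ 1))
      where
      open AroundBlock v₀ v₀∈ b₀
      length-nonzeroVectors′ : length nonzeroVectors ℕ.+ 1 ≡ 2 ℕ.^ suc l
      length-nonzeroVectors′ = trans length-nonzeroVectors (cong (2 ℕ.^_) ℓ≡1+l)
      count : ∀ s c D → s ≢ s₂ → (∀ {v} → v ∈ nonzeroVectors → v ≢ v₀ → countAt (meetsIn? s) v ≡ c) → c ℕ.* 2 ≡ D →
        HasCount (λ B → IsBlock K F B × MeetsIn s B) (D ℕ.* (2 ℕ.^ l ℕ.∸ 1))
      count s c D s≢s₂ other≡c c*2≡D =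
        hasCount-blocks (meetsIn? s) _ (sum-others l (length nonzeroVectors) (total s) c D length-nonzeroVectors′ total+c c*2≡D)
        where
        total+c : total s ℕ.+ c ≡ 0 ℕ.+ length nonzeroVectors ℕ.* c
        total+c = trans (total-split s c (λ v v∈ v≢v₀ → other≡c v∈ v≢v₀)) (cong (ℕ._+ length nonzeroVectors ℕ.* c) (countAt-self s s≢s₂))
      total-s₂ : total s₂ ≡ q ℕ.∸ 1
      total-s₂ = begin
        total s₂                                ≡⟨ sym (ℕP.+-identityʳ _) ⟩
        total s₂ ℕ.+ 0                          ≡⟨ total-split s₂ 0 (λ v v∈ v≢v₀ → Other.countAt-s₂ v∈ v≢v₀) ⟩
        countAt (meetsIn? s₂) v₀ ℕ.+ length nonzeroVectors ℕ.* 0 ≡⟨ cong (countAt (meetsIn? s₂) v₀ ℕ.+_) (ℕP.*-zeroʳ (length nonzeroVectors)) ⟩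
        countAt (meetsIn? s₂) v₀ ℕ.+ 0          ≡⟨ sym (ℕP.+-∸-assoc _ {1} {1} ℕP.≤-refl) ⟩
        countAt (meetsIn? s₂) v₀ ℕ.+ 1 ℕ.∸ 1    ≡⟨ cong (ℕ._∸ 1) countAt-self-s₂ ⟩
        q ℕ.∸ 1                                 ∎

    codeword-isBlock⊎∁isBlock : ∀ a → Nonzero a → ∀ b c → IsBlock K F (codeword a b c) ⊎ IsBlock K F (∁ (codeword a b c))
    codeword-isBlock⊎∁isBlock a a≢0 b c with c BP.≟ dual f⟨ a ⟩ b
    ... | yes refl = inj₁ (block-isBlock a a≢0 b)
    ... | no  c≢d  = inj₂ (subst (IsBlock K F) (sym (trans (∁-codeword a b c) (cong (codeword a b) (sym (BP.¬-not (c≢d ∘ sym))))))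
                                  (block-isBlock a a≢0 b))

  module SingleFunction (t : ℕ) (K : GF2^ (2 ℕ.* suc (suc t))) (F : Fin 1 → Carrier K → Bool)
                        (bent : IsBentVectorial (suc (suc t)) K F) where
    open BlockDesign t K F bent Fin.zero public
    open ≡-Reasoning

    𝟏 : Fin 1 → Bool
    𝟏 _ = true

    𝟏-nonzero : Nonzero 𝟏
    𝟏-nonzero = Fin.zero , refl

    nonzero⇒𝟏 : ∀ a → Nonzero a → ∀ j → a j ≡ 𝟏 j
    nonzero⇒𝟏 a (Fin.zero , e) Fin.zero = e

    isBlock⇒block𝟏 : ∀ {B} → IsBlock K F B → ∃[ b ] (B ≡ block 𝟏 b)
    isBlock⇒block𝟏 B-block with isBlock⇒label B-block
    ... | v , v∈ , b , refl = b , block-cong (nonzero⇒𝟏 (V.lookup v) (∈-nonzeroVectors⁻ v∈)) b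

    length-nonzeroVectors≡1 : length nonzeroVectors ≡ 1
    length-nonzeroVectors≡1 = ℕP.+-cancelʳ-≡ _ 1 1 length-nonzeroVectors

    sum-nonzeroVectors : ∀ (f : Vec Bool 1 → ℕ) c → (∀ v → v ∈ nonzeroVectors → f v ≡ c) → sum (map f nonzeroVectors) ≡ c
    sum-nonzeroVectors f c f≡c = begin
      sum (map f nonzeroVectors)              ≡⟨ sum-map-cong nonzeroVectors f≡c ⟩
      sum (map (λ _ → c) nonzeroVectors)      ≡⟨ sum-map-const c nonzeroVectors ⟩
      length nonzeroVectors ℕ.* c             ≡⟨ cong (ℕ._* c) length-nonzeroVectors≡1 ⟩
      1 ℕ.* c                                 ≡⟨ ℕP.*-identityˡ c ⟩
      c                                       ∎

    intersection-s₂ : ∀ {B B′} → IsBlock K F B → IsBlock K F B′ → B ≢ B′ → ∣ B ∩ B′ ∣ ≡ s₂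
    intersection-s₂ B-block B′-block B≢B′ with isBlock⇒block𝟏 B-block | isBlock⇒block𝟏 B′-block
    ... | b , refl | b′ , refl with b ≟ b′
    ...   | yes refl = ⊥-elim (B≢B′ refl)
    ...   | no  b≢b′ = ∣∩∣≡s₂ 𝟏 𝟏-nonzero b 𝟏 𝟏-nonzero b′ (nonzero[a⊻a] 𝟏) b≢b′

    -- the symmetric difference of three blocks is again a codeword with a = 1
    hasSDP : HasSDP (IsBlock K F)
    hasSDP B₁ B₂ B₃ B₁-block B₂-block B₃-block with isBlock⇒block𝟏 B₁-block | isBlock⇒block𝟏 B₂-block | isBlock⇒block𝟏 B₃-block
    ... | b₁ , refl | b₂ , refl | b₃ , refl =
      subst (λ C → IsBlock K F C ⊎ IsBlock K F (∁ C)) (sym sum≡codeword) (codeword-isBlock⊎∁isBlock 𝟏 𝟏-nonzero (b₁ + b₂ + b₃) c)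
      where
      d : 𝔽 → Bool
      d = dual f⟨ 𝟏 ⟩
      c = (d b₁ xor d b₂) xor d b₃
      sum≡codeword : (block 𝟏 b₁ ⊕ block 𝟏 b₂) ⊕ block 𝟏 b₃ ≡ codeword 𝟏 (b₁ + b₂ + b₃) c
      sum≡codeword = begin
        (block 𝟏 b₁ ⊕ block 𝟏 b₂) ⊕ block 𝟏 b₃                      ≡⟨ cong (_⊕ block 𝟏 b₃) (codeword-⊕ 𝟏 b₁ (d b₁) 𝟏 b₂ (d b₂)) ⟩
        codeword (𝟏 ⊻ 𝟏) (b₁ + b₂) (d b₁ xor d b₂) ⊕ block 𝟏 b₃     ≡⟨ codeword-⊕ (𝟏 ⊻ 𝟏) (b₁ + b₂) _ 𝟏 b₃ (d b₃) ⟩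
        codeword ((𝟏 ⊻ 𝟏) ⊻ 𝟏) (b₁ + b₂ + b₃) c                     ≡⟨ codeword-cong {a = (𝟏 ⊻ 𝟏) ⊻ 𝟏} {a′ = 𝟏} (λ _ → refl) (b₁ + b₂ + b₃) c ⟩
        codeword 𝟏 (b₁ + b₂ + b₃) c                                 ∎

    block-size : ∀ {B} → IsBlock K F B → ∣ B ∣ ≡ ∣ block 𝟏 0# ∣
    block-size B-block with isBlock⇒block𝟏 B-block
    ... | b , refl = ℕP.*-cancelʳ-≡ _ _ 2 (ℤP.+-injective (begin
      pos (wt (block 𝟏 b) ℕ.* 2)            ≡⟨ ℤP.pos-* (wt (block 𝟏 b)) 2 ⟩
      pos (wt (block 𝟏 b)) ℤ.* pos 2        ≡⟨ +-cancelʳ M _ _ (trans (wt-block 𝟏 𝟏-nonzero b) (sym (wt-block 𝟏 𝟏-nonzero 0#))) ⟩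
      pos (wt (block 𝟏 0#)) ℤ.* pos 2       ≡⟨ sym (ℤP.pos-* (wt (block 𝟏 0#)) 2) ⟩
      pos (wt (block 𝟏 0#) ℕ.* 2)           ∎))

    both? : ∀ i j → Decidable (λ (B : Vec Bool q) → i Subset.∈ B × j Subset.∈ B)
    both? i j B = i ∈? B ×-dec j ∈? B

    countAt-both : ∀ i j → i ≢ j → ∀ v → v ∈ nonzeroVectors → countAt (both? i j) v ≡ s₂
    countAt-both i j i≢j v v∈ = X*4+kM≡Q⇒X≡P∸kA 2 (s≤s (s≤s z≤n)) _ (begin
      pos (countAt (both? i j) v) ℤ.* pos 4 ℤ.+ pos 2 ℤ.* M
          ≡⟨ cong (λ z → z ℤ.* pos 4 ℤ.+ pos 2 ℤ.* M) (trans (countAt≡∑ (both? i j) v) (∑-cong (λ b → cong (pos ∘ 𝟙) (does-both b)))) ⟩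
      ∑ (λ b → pos (𝟙 (blockWord a b (u i) ∧ blockWord a b (u j)))) ℤ.* pos 4 ℤ.+ pos 2 ℤ.* M
          ≡⟨ ∑𝟙[both]*4 a (∈-nonzeroVectors⁻ v∈) (u i) (u j) (i≢j ∘ u-injective) ⟩
      Q   ∎)
      where
      a = V.lookup v
      does-both : ∀ b → does (both? i j (block a b)) ≡ (blockWord a b (u i) ∧ blockWord a b (u j))
      does-both b = cong₂ _∧_ (trans (does-∈? i (block a b)) (VP.lookup∘tabulate (blockWord a b ∘ u) i))
                              (trans (does-∈? j (block a b)) (VP.lookup∘tabulate (blockWord a b ∘ u) j))

    length-blocks : length blocks ≡ q
    length-blocks = begin
      length blocks                                               ≡⟨ LP.length-map blockAt (cartesianProduct nonzeroVectors elements) ⟩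
      length (cartesianProduct nonzeroVectors elements)           ≡⟨ length-cartesianProduct nonzeroVectors elements ⟩
      length nonzeroVectors ℕ.* length elements                   ≡⟨ cong₂ ℕ._*_ length-nonzeroVectors≡1 length-elements ⟩
      1 ℕ.* q                                                     ≡⟨ ℕP.*-identityˡ q ⟩
      q                                                           ∎

    isSymmetricDesign : IsSymmetricDesign (IsBlock K F)
    isSymmetricDesign =
      (∣ block 𝟏 0# ∣ , s₂ , (λ _ → block-size) ,
        λ i j i≢j → hasCount-blocks (both? i j) s₂ (sum-nonzeroVectors _ s₂ (countAt-both i j i≢j))) ,
      (blocks , blocks-unique , length-blocks , ∈blocks⇔isBlock)

open import Defs
open Design using (module BlockDesign; module SingleFunction)
open import Data.Nat using (ℕ; suc; z≤n; s≤s; _≤_; _*_; _+_; _∸_; _^_)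
open import Data.Fin as Fin using (Fin)
open import Data.Bool using (Bool)
open import Data.Fin.Subset using (Subset; ∣_∣; _∩_)
open import Data.Product using (_×_; _,_)
open import Data.Sum using (_⊎_)
open import Relation.Binary.PropositionalEquality using (_≡_; _≢_; refl)

theorem19 : (m : ℕ) → 2 ≤ m → (K : GF2^ (2 * m)) → (ℓ : ℕ) → 1 ≤ ℓ → ℓ ≤ m →
    (F : Fin ℓ → Carrier K → Bool) → IsBentVectorial m K F →
    (ℓ ≡ 1 →
      IsSymmetricSDPDesign (IsBlock K F) ×
      (∀ B B′ → IsBlock K F B → IsBlock K F B′ → B ≢ B′ →
        ∣ B ∩ B′ ∣ ≡ 2 ^ (2 * m ∸ 2) ∸ 2 ^ (m ∸ 1)))
    ×
    (2 ≤ ℓ →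
      (∀ B B′ → IsBlock K F B → IsBlock K F B′ → B ≢ B′ →
        (∣ B ∩ B′ ∣ ≡ 2 ^ (2 * m ∸ 2) ∸ 2 ^ (m ∸ 2)) ⊎
        (∣ B ∩ B′ ∣ ≡ 2 ^ (2 * m ∸ 2) ∸ 2 ^ (m ∸ 1)) ⊎
        (∣ B ∩ B′ ∣ ≡ 2 ^ (2 * m ∸ 2) ∸ 3 * 2 ^ (m ∸ 2)))
      ×
      (∀ B → IsBlock K F B →
        HasCount (λ B′ → IsBlock K F B′ × B′ ≢ B × ∣ B ∩ B′ ∣ ≡ 2 ^ (2 * m ∸ 2) ∸ 2 ^ (m ∸ 2))
          (2 ^ m * (2 ^ m + 1) * (2 ^ (ℓ ∸ 1) ∸ 1)) ×
        HasCount (λ B′ → IsBlock K F B′ × B′ ≢ B × ∣ B ∩ B′ ∣ ≡ 2 ^ (2 * m ∸ 2) ∸ 2 ^ (m ∸ 1))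
          (2 ^ (2 * m) ∸ 1) ×
        HasCount (λ B′ → IsBlock K F B′ × B′ ≢ B × ∣ B ∩ B′ ∣ ≡ 2 ^ (2 * m ∸ 2) ∸ 3 * 2 ^ (m ∸ 2))
          (2 ^ m * (2 ^ m ∸ 1) * (2 ^ (ℓ ∸ 1) ∸ 1))))
theorem19 (suc (suc t)) (s≤s (s≤s z≤n)) K (suc l) (s≤s z≤n) _ F bent =
  (λ { refl → let open SingleFunction t K F bent in (isSymmetricDesign , hasSDP) , λ _ _ → intersection-s₂ }) ,
  (λ _ → (λ _ _ → intersection-sizes) , (λ _ → neighbourCounts l refl))
  where open BlockDesign t K F bent Fin.zero
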